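{- For integers $s,t\geq 7$, $$\dim_s(C_s\diamond C_t)=st-4\min\left\{\left\lfloor \tfrac{s}{3}\right\rfloor,\left\lfloor \tfrac{t}{3}\right\rfloor\right\}-r,$$ where $r=0$ if $\min\{s,t\}\equiv 0$ or $1 \pmod 3$; $r=1$ if $s=t$ and $\min\{s,t\}\equiv 2\pmod 3$; and $r=2$ if $s\neq t$ and $\min\{s,t\}\equiv 2\pmod 3$.
   Context: $C_n$ is the cycle on $n$ vertices. The modular product $G\diamond H$ has vertex set $V(G)\times V(H)$, and $(g,h)$, $(g',h')$ are adjacent if $g=g'$ and $hh'\in E(H)$, or $gg'\in E(G)$ and $h=h'$, or $gg'\in E(G)$ and $hh'\in E(H)$, or ($g\neq g'$, $h\neq h'$, $gg'\notin E(G)$ and $hh'\notin E(H)$). For a connected graph $X$, a vertex $z$ strongly resolves distinct vertices $x,y$ if $d_X(y,z)=d_X(y,x)+d_X(x,z)$ or $d_X(x,z)=d_X(x,y)+d_X(y,z)$; $\dim_s(X)$ is the minimum cardinality of a set $S\subseteq V(X)$ such that every two distinct vertices are strongly resolved by some vertex of $S$. -}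

module Defs where

open import Data.Nat using (ℕ; zero; suc; _+_; _*_; _∸_; _≤_; _⊓_; _/_; _%_)
open import Data.Nat.Properties using (_≟_)
open import Data.Fin using (Fin; toℕ)
open import Data.Product using (Σ; _×_; _,_; ∃)
open import Data.Sum using (_⊎_)
open import Data.List using (List; length)
open import Data.List.Membership.Propositional using (_∈_)
open import Data.List.Relation.Unary.Unique.Propositional using (Unique)
open import Relation.Binary.PropositionalEquality using (_≡_; _≢_)
open import Relation.Nullary using (¬_; yes; no)

record Graph : Set₁ where
  field
    V   : Set
    _~_ : V → V → Set
open Graph public

CycleAdj : (n : ℕ) → Fin n → Fin n → Set
CycleAdj n i j =
  (toℕ j ≡ suc (toℕ i)) ⊎ (toℕ i ≡ suc (toℕ j)) ⊎
  ((toℕ i ≡ 0) × (suc (toℕ j) ≡ n)) ⊎ ((toℕ j ≡ 0) × (suc (toℕ i) ≡ n))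

Cycle : ℕ → Graph
Cycle n = record { V = Fin n ; _~_ = CycleAdj n }

ModAdj : (G H : Graph) → (V G × V H) → (V G × V H) → Set
ModAdj G H (g , h) (g' , h') =
  ((g ≡ g') × (_~_ H h h')) ⊎
  ((_~_ G g g') × (h ≡ h')) ⊎
  ((_~_ G g g') × (_~_ H h h')) ⊎
  ((g ≢ g') × (h ≢ h') × ¬ (_~_ G g g') × ¬ (_~_ H h h'))

_◇_ : Graph → Graph → Graph
G ◇ H = record { V = V G × V H ; _~_ = ModAdj G H }

data Walk (G : Graph) : V G → V G → ℕ → Set where
  here  : ∀ {x} → Walk G x x 0
  there : ∀ {x y z k} → _~_ G x y → Walk G y z k → Walk G x z (suc k)

Dist : (G : Graph) → V G → V G → ℕ → Set
Dist G x y d = Walk G x y d × (∀ k → Walk G x y k → d ≤ k)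

StronglyResolves : (G : Graph) → V G → V G → V G → Set
StronglyResolves G z x y =
  (Σ ℕ λ a → Σ ℕ λ b → Σ ℕ λ c →
     Dist G y z a × Dist G y x b × Dist G x z c × (a ≡ b + c)) ⊎
  (Σ ℕ λ a → Σ ℕ λ b → Σ ℕ λ c →
     Dist G x z a × Dist G x y b × Dist G y z c × (a ≡ b + c))

IsStrongResolvingSet : (G : Graph) → List (V G) → Set
IsStrongResolvingSet G S =
  ∀ x y → x ≢ y → ∃ λ z → (z ∈ S) × StronglyResolves G z x y

StrongMetricDim : (G : Graph) → ℕ → Set
StrongMetricDim G m =
  (Σ (List (V G)) λ S → Unique S × IsStrongResolvingSet G S × (length S ≡ m)) ×
  (∀ S → Unique S → IsStrongResolvingSet G S → m ≤ length S)

r-term : ℕ → ℕ → ℕ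
r-term s t with (s ⊓ t) % 3 ≟ 2
... | no _ = 0
... | yes _ with s ≟ t
...   | yes _ = 1
...   | no _  = 2

dimFormula : ℕ → ℕ → ℕ
dimFormula s t = s * t ∸ 4 * ((s / 3) ⊓ (t / 3)) ∸ r-term s t

{-# OPTIONS --safe #-}
module Submission where

-- C_s ◇ C_t has diameter 2: vertices at distance 2 are strongly resolved only by themselves, while an
-- edge xy is resolved by any neighbour z of x at distance 2 from y, and such a z always exists.  Hence
-- S is strongly resolving iff its complement is a clique, and dim_s = st − ω.
-- In a clique W the column counts c_i are at most 2, and three consecutive nonempty columns hold one
-- vertex each, so every window c_i + c_{i+1} + c_{i+2} is at most 4.  Summing the windows around the
-- cycle counts W three times: 3|W| + D = 4s, where the defect D is the total shortfall of the windows.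
-- A column with one vertex makes three windows short (D ≥ 3); otherwise all counts are even and so is
-- D.  Thus D ≠ 1, which gives |W| ≤ 4⌊s/3⌋ + r except when s = t ≡ 2 (mod 3) and D = 2.  Then some
-- nonempty column has empty neighbours; a vertex in it is alone in its row, so the defect of the row
-- counts is ≥ 3, whereas for s = t it equals D.  Disjoint 2×2 blocks along the diagonal attain the bound.

open import Function using (_∘_)
open import Data.Bool using (true; false; if_then_else_)
open import Data.Nat using (ℕ; zero; suc; _+_; _*_; _∸_; _≤_; _<_; z≤n; s≤s; NonZero; >-nonZero; >-nonZero⁻¹;
                            _%_; _/_; _⊓_; _≤?_; _<?_)
open import Data.Nat.Properties
open import Data.Nat.DivMod
open import Data.Nat.Divisibility
  using (_∣_; _∣0; ∣-refl; ∣m∣n⇒∣m+n; ∣m+n∣m⇒∣n; n∣m*n; ∣1⇒≡1; ∣⇒≤)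
open import Data.Nat.Tactic.RingSolver using (solve-∀)
open import Data.Fin using (Fin; toℕ; fromℕ<)
open import Data.Fin.Properties using (toℕ-injective; toℕ<n; toℕ-fromℕ<) renaming (_≟_ to _≟ᶠ_)
open import Data.Product using (_×_; _,_; ∃; ∃-syntax; proj₁; proj₂; swap)
open import Data.Product.Properties using (×-≡,≡→≡; ≡-dec)
open import Data.Sum using (_⊎_; inj₁; inj₂)
import Data.Sum as Sum
open import Data.Empty using (⊥; ⊥-elim)
open import Data.List using (List; []; _∷_; length; filter; map; take; _++_; allFin; cartesianProduct)
open import Data.List.Properties using (length-++; length-map; length-take; length-tabulate; filter-≐)
open import Data.List.Membership.Propositional using (_∈_; _∉_)
open import Data.List.Membership.Propositional.Properties
  using (∈-filter⁺; ∈-filter⁻; ∈-∃++; ∈-++⁻; ∈-++⁺ˡ; ∈-++⁺ʳ; ∈-map⁺; ∈-map⁻;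
         ∈-cartesianProduct⁺; ∈-allFin)
open import Data.List.Relation.Unary.Any using (here; there)
open import Data.List.Relation.Unary.All as All using (All; []; _∷_)
open import Data.List.Relation.Unary.AllPairs as AllPairs using (AllPairs; []; _∷_)
import Data.List.Relation.Unary.AllPairs.Properties as AllPairs
open import Data.List.Relation.Unary.Unique.Propositional using (Unique)
import Data.List.Relation.Unary.Unique.Propositional.Properties as Unique
open import Relation.Nullary using (¬_; Dec; yes; no; does; contradiction)
open import Relation.Nullary.Decidable using (_×-dec_; _⊎-dec_; ¬?)
open import Relation.Unary using (Decidable; _≐_)
open import Relation.Binary.Definitions using (DecidableEquality)
open import Relation.Binary.PropositionalEquality
open import Algebra.Properties.CommutativeSemigroup +-commutativeSemigroup using (interchange)
open import Defs

∑< : ℕ → (ℕ → ℕ) → ℕ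
∑< zero    f = 0
∑< (suc n) f = f 0 + ∑< n (f ∘ suc)

syntax ∑< n (λ i → e) = ∑[ i < n ] e

∑-cong : ∀ n {f g : ℕ → ℕ} → (∀ i → i < n → f i ≡ g i) → ∑< n f ≡ ∑< n g
∑-cong zero    f≗g = refl
∑-cong (suc n) f≗g = cong₂ _+_ (f≗g 0 (s≤s z≤n)) (∑-cong n (λ i i<n → f≗g (suc i) (s≤s i<n)))

∑-distrib-+ : ∀ n (f g : ℕ → ℕ) → ∑[ i < n ] (f i + g i) ≡ ∑< n f + ∑< n g
∑-distrib-+ zero    f g = refl
∑-distrib-+ (suc n) f g =
  trans (cong (f 0 + g 0 +_) (∑-distrib-+ n (f ∘ suc) (g ∘ suc))) (interchange (f 0) (g 0) _ _)

∑-const : ∀ n k → ∑[ i < n ] k ≡ n * k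
∑-const zero    k = refl
∑-const (suc n) k = cong (k +_) (∑-const n k)

∑-last : ∀ n f → ∑< (suc n) f ≡ ∑< n f + f n
∑-last zero    f = +-comm (f 0) 0
∑-last (suc n) f = trans (cong (f 0 +_) (∑-last n (f ∘ suc))) (sym (+-assoc (f 0) _ _))

∑-shift : ∀ n f → f n ≡ f 0 → ∑< n (f ∘ suc) ≡ ∑< n f
∑-shift n f fn≡f0 = +-cancelˡ-≡ (f 0) _ _ (begin
  f 0 + ∑< n (f ∘ suc) ≡⟨ ∑-last n f ⟩
  ∑< n f + f n         ≡⟨ cong (∑< n f +_) fn≡f0 ⟩
  ∑< n f + f 0         ≡⟨ +-comm (∑< n f) (f 0) ⟩
  f 0 + ∑< n f         ∎)
  where open ≡-Reasoning

∑-rotate : ∀ n a f → (∀ i → f (i + n) ≡ f i) → ∑[ i < n ] f (i + a) ≡ ∑< n f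
∑-rotate n zero    f periodic = ∑-cong n (λ i _ → cong f (+-identityʳ i))
∑-rotate n (suc a) f periodic = begin
  ∑[ i < n ] f (i + suc a)   ≡⟨ ∑-cong n (λ i _ → cong f (+-suc i a)) ⟩
  ∑[ i < n ] f (suc i + a)   ≡⟨ ∑-shift n (λ i → f (i + a)) (trans (cong f (+-comm n a)) (periodic a)) ⟩
  ∑[ i < n ] f (i + a)       ≡⟨ ∑-rotate n a f periodic ⟩
  ∑< n f                     ∎
  where open ≡-Reasoning

∑-consecutive-three : ∀ {n} f → (∀ i → f (i + n) ≡ f i) → 3 ≤ n → ∀ a →
                      f a + f (suc a) + f (suc (suc a)) ≤ ∑< n f
∑-consecutive-three {n} f periodic 3≤n a =
  ≤-trans (first-three (λ i → f (i + a)) 3≤n) (≤-reflexive (∑-rotate n a f periodic))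
  where
  first-three : ∀ {n} g → 3 ≤ n → g 0 + g 1 + g 2 ≤ ∑< n g
  first-three {suc (suc (suc n))} g (s≤s (s≤s (s≤s _))) = begin
    g 0 + g 1 + g 2                 ≡⟨ +-assoc (g 0) (g 1) (g 2) ⟩
    g 0 + (g 1 + g 2)               ≤⟨ +-monoʳ-≤ (g 0) (+-monoʳ-≤ (g 1) (m≤m+n (g 2) _)) ⟩
    g 0 + (g 1 + (g 2 + ∑< n _))    ∎
    where open ≤-Reasoning

∑-positive : ∀ n f → 0 < ∑< n f → ∃[ i ] 0 < f i
∑-positive (suc n) f 0<∑ with f 0 in f0≡
... | suc _ = 0 , subst (0 <_) (sym f0≡) (s≤s z≤n)
... | zero with ∑-positive n (f ∘ suc) 0<∑
...   | i , 0<fi = suc i , 0<fi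

∑-even : ∀ n f → (∀ i → 2 ∣ f i) → 2 ∣ ∑< n f
∑-even zero    f even = 2 ∣0
∑-even (suc n) f even = ∣m∣n⇒∣m+n (even 0) (∑-even n (f ∘ suc) (even ∘ suc))

δ : ℕ → ℕ → ℕ
δ v i = if does (v ≟ i) then 1 else 0

∑-δ : ∀ {n v} → v < n → ∑[ i < n ] δ v i ≡ 1
∑-δ {suc n} {zero}  _         = cong suc (trans (∑-const n 0) (*-zeroʳ n))
∑-δ {suc n} {suc v} (s≤s v<n) = ∑-δ v<n

∑-length-filter-≟ : ∀ n {A : Set} (key : A → ℕ) xs → (∀ {x} → x ∈ xs → key x < n) →
                    ∑[ i < n ] length (filter (λ x → key x ≟ i) xs) ≡ length xs
∑-length-filter-≟ n key []       _      = trans (∑-const n 0) (*-zeroʳ n)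
∑-length-filter-≟ n key (x ∷ xs) keys<n = begin
  ∑[ i < n ] length (filter (λ y → key y ≟ i) (x ∷ xs))           ≡⟨ ∑-cong n (λ i _ → length-filter-∷ i) ⟩
  ∑[ i < n ] (δ (key x) i + length (filter (λ y → key y ≟ i) xs))  ≡⟨ ∑-distrib-+ n (δ (key x)) _ ⟩
  ∑[ i < n ] δ (key x) i + ∑[ i < n ] length (filter (λ y → key y ≟ i) xs)
    ≡⟨ cong₂ _+_ (∑-δ (keys<n (here refl))) (∑-length-filter-≟ n key xs (keys<n ∘ there)) ⟩
  suc (length xs)                                                   ∎
  where
  open ≡-Reasoning
  length-filter-∷ : ∀ i → length (filter (λ y → key y ≟ i) (x ∷ xs)) ≡
                          δ (key x) i + length (filter (λ y → key y ≟ i) xs)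
  length-filter-∷ i with does (key x ≟ i)
  ... | true  = refl
  ... | false = refl

module _ {A : Set} where

  ∈⇒0<length : ∀ {x : A} {xs} → x ∈ xs → 0 < length xs
  ∈⇒0<length (here _)  = s≤s z≤n
  ∈⇒0<length (there _) = s≤s z≤n

  0<length⇒∈ : ∀ {xs : List A} → 0 < length xs → ∃[ x ] x ∈ xs
  0<length⇒∈ {x ∷ _} _ = x , here refl

  two-distinct : ∀ {xs : List A} → Unique xs → 2 ≤ length xs → ∃[ x ] ∃[ y ] x ∈ xs × y ∈ xs × x ≢ y
  two-distinct {x ∷ y ∷ _} ((x≢y ∷ _) ∷ _) _ = x , y , here refl , there (here refl) , x≢y
  two-distinct {_ ∷ []}    _               (s≤s ())

  three-distinct : ∀ {xs : List A} → Unique xs → 3 ≤ length xs →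
                   ∃[ x ] ∃[ y ] ∃[ z ] x ∈ xs × y ∈ xs × z ∈ xs × x ≢ y × x ≢ z × y ≢ z
  three-distinct {x ∷ y ∷ z ∷ _} ((x≢y ∷ x≢z ∷ _) ∷ (y≢z ∷ _) ∷ _) _ =
    x , y , z , here refl , there (here refl) , there (there (here refl)) , x≢y , x≢z , y≢z
  three-distinct {_ ∷ []}     _ (s≤s ())
  three-distinct {_ ∷ _ ∷ []} _ (s≤s (s≤s ()))

  length≡1 : ∀ {x : A} {xs} → Unique xs → x ∈ xs → (∀ {y} → y ∈ xs → y ≡ x) → length xs ≡ 1
  length≡1 {xs = _ ∷ []}    _               _ _     = refl
  length≡1 {xs = _ ∷ _ ∷ _} ((y≢z ∷ _) ∷ _) _ all≡x =
    contradiction (trans (all≡x (here refl)) (sym (all≡x (there (here refl))))) y≢z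

  Unique∧⊆⇒length≤ : ∀ {xs ys : List A} → Unique xs → (∀ {x} → x ∈ xs → x ∈ ys) →
                     length xs ≤ length ys
  Unique∧⊆⇒length≤ {[]}     _                  _     = z≤n
  Unique∧⊆⇒length≤ {x ∷ xs} (x∉xs ∷ xs-unique) xs⊆ys with ∈-∃++ (xs⊆ys (here refl))
  ... | ys₁ , ys₂ , refl = begin
    suc (length xs)               ≤⟨ s≤s (Unique∧⊆⇒length≤ xs-unique xs⊆ys₁++ys₂) ⟩
    suc (length (ys₁ ++ ys₂))     ≡⟨ cong suc (length-++ ys₁) ⟩
    suc (length ys₁ + length ys₂) ≡⟨ +-suc (length ys₁) (length ys₂) ⟨
    length ys₁ + length (x ∷ ys₂) ≡⟨ length-++ ys₁ ⟨
    length (ys₁ ++ x ∷ ys₂)       ∎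
    where
    open ≤-Reasoning
    xs⊆ys₁++ys₂ : ∀ {y} → y ∈ xs → y ∈ ys₁ ++ ys₂
    xs⊆ys₁++ys₂ {y} y∈xs with ∈-++⁻ ys₁ (xs⊆ys (there y∈xs))
    ... | inj₁ y∈ys₁         = ∈-++⁺ˡ y∈ys₁
    ... | inj₂ (here refl)   = contradiction refl (All.lookup x∉xs y∈xs)
    ... | inj₂ (there y∈ys₂) = ∈-++⁺ʳ ys₁ y∈ys₂

  length-filter+length-filter-¬ : ∀ {P : A → Set} (P? : Decidable P) xs →
                                  length (filter P? xs) + length (filter (¬? ∘ P?) xs) ≡ length xs
  length-filter+length-filter-¬ P? [] = refl
  length-filter+length-filter-¬ P? (x ∷ xs) with P? x
  ... | yes _ = cong suc (length-filter+length-filter-¬ P? xs)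
  ... | no  _ = trans (+-suc _ _) (cong suc (length-filter+length-filter-¬ P? xs))

  AllPairs⇒pairwise : ∀ {R : A → A → Set} {xs} → (∀ {x y} → R x y → R y x) → AllPairs R xs →
                      ∀ {x y} → x ∈ xs → y ∈ xs → x ≢ y → R x y
  AllPairs⇒pairwise R-sym (_  ∷ _)   (here refl) (here refl) x≢y = ⊥-elim (x≢y refl)
  AllPairs⇒pairwise R-sym (Rx ∷ _)   (here refl) (there y∈)  _   = All.lookup Rx y∈
  AllPairs⇒pairwise R-sym (Ry ∷ _)   (there x∈)  (here refl) _   = R-sym (All.lookup Ry x∈)
  AllPairs⇒pairwise R-sym (_  ∷ Rxs) (there x∈)  (there y∈)  x≢y = AllPairs⇒pairwise R-sym Rxs x∈ y∈ x≢y

length-cartesianProduct : ∀ {A B : Set} (xs : List A) (ys : List B) →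
                          length (cartesianProduct xs ys) ≡ length xs * length ys
length-cartesianProduct []       ys = refl
length-cartesianProduct (x ∷ xs) ys =
  trans (length-++ (map (x ,_) ys)) (cong₂ _+_ (length-map (x ,_) ys) (length-cartesianProduct xs ys))

module Complement {A : Set} (_≟_ : DecidableEquality A) (vs : List A) (vs-unique : Unique vs) where

  open import Data.List.Membership.DecPropositional _≟_ using (_∈?_)

  _∉?_ : ∀ x W → Dec (x ∉ W)
  x ∉? W = ¬? (x ∈? W)

  complement : List A → List A
  complement W = filter (_∉? W) vs

  complement-unique : ∀ W → Unique (complement W)
  complement-unique W = Unique.filter⁺ (_∉? W) vs-unique

  ∈-complement⁺ : ∀ {W x} → x ∈ vs → x ∉ W → x ∈ complement W
  ∈-complement⁺ {W} = ∈-filter⁺ (_∉? W)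

  ∉-complement : ∀ {W x} → x ∈ complement W → x ∉ W
  ∉-complement {W} = proj₂ ∘ ∈-filter⁻ (_∉? W) {xs = vs}

  length-complement : ∀ {W} → Unique W → (∀ {x} → x ∈ W → x ∈ vs) →
                      length (complement W) + length W ≡ length vs
  length-complement {W} W-unique W⊆vs = begin
    length (complement W) + length W                    ≡⟨ +-comm _ (length W) ⟩
    length W + length (complement W)                    ≡⟨ cong (_+ length (complement W)) length-W ⟨
    length (filter (_∈? W) vs) + length (complement W)  ≡⟨ length-filter+length-filter-¬ (_∈? W) vs ⟩
    length vs                                           ∎
    where
    open ≡-Reasoning
    length-W : length (filter (_∈? W) vs) ≡ length W
    length-W = ≤-antisym
      (Unique∧⊆⇒length≤ (Unique.filter⁺ (_∈? W) vs-unique) (proj₂ ∘ ∈-filter⁻ (_∈? W) {xs = vs}))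
      (Unique∧⊆⇒length≤ W-unique (λ x∈W → ∈-filter⁺ (_∈? W) (W⊆vs x∈W) x∈W))

-- Graphs of diameter two

Close Far : (G : Graph) → V G → V G → Set
Close G x y = x ≡ y ⊎ _~_ G x y
Far   G x y = x ≢ y × ¬ _~_ G x y

far-sym : ∀ (G : Graph) → (∀ {a b} → _~_ G a b → _~_ G b a) → ∀ {a b} → Far G a b → Far G b a
far-sym G G-sym (a≢b , a≁b) = a≢b ∘ sym , a≁b ∘ G-sym

close⇒¬far : ∀ (G : Graph) {a b} → Close G a b → ¬ Far G a b
close⇒¬far G (inj₁ a≡b) (a≢b , _) = a≢b a≡b
close⇒¬far G (inj₂ a~b) (_ , a≁b) = a≁b a~b

IsClique : (G : Graph) → List (V G) → Set
IsClique G W = ∀ {x y} → x ∈ W → y ∈ W → x ≢ y → _~_ G x y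

module DiameterTwo
  (G : Graph)
  (_≟_ : DecidableEquality (V G))
  (adjacent? : ∀ x y → Dec (_~_ G x y))
  (~-sym : ∀ {x y} → _~_ G x y → _~_ G y x)
  (~-irrefl : ∀ {x} → ¬ _~_ G x x)
  (walk₂ : ∀ x y → Walk G x y 2)
  where

  open Graph G using () renaming (_~_ to _∼_)

  private
    walk₀ : ∀ {x y} → Walk G x y 0 → x ≡ y
    walk₀ here = refl

    walk₁ : ∀ {x y} → Walk G x y 1 → x ∼ y
    walk₁ (there x∼y here) = x∼y

  dist-refl : ∀ x → Dist G x x 0
  dist-refl x = here , λ _ _ → z≤n

  dist-adjacent : ∀ {x y} → x ∼ y → Dist G x y 1
  dist-adjacent {x} x∼y = there x∼y here , λ
    { zero    w → ⊥-elim (~-irrefl (subst (x ∼_) (sym (walk₀ w)) x∼y))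
    ; (suc k) _ → s≤s z≤n }

  dist-nonadjacent : ∀ {x y} → x ≢ y → ¬ x ∼ y → Dist G x y 2
  dist-nonadjacent {x} {y} x≢y x≁y = walk₂ x y , λ
    { zero          w → ⊥-elim (x≢y (walk₀ w))
    ; (suc zero)    w → ⊥-elim (x≁y (walk₁ w))
    ; (suc (suc k)) _ → s≤s (s≤s z≤n) }

  dist-exists : ∀ x y → ∃ (Dist G x y)
  dist-exists x y with x ≟ y | adjacent? x y
  ... | yes refl | _       = 0 , dist-refl x
  ... | no x≢y   | yes x∼y = 1 , dist-adjacent x∼y
  ... | no x≢y   | no x≁y  = 2 , dist-nonadjacent x≢y x≁y

  dist-unique : ∀ {x y a b} → Dist G x y a → Dist G x y b → a ≡ b
  dist-unique (walk-a , min-a) (walk-b , min-b) = ≤-antisym (min-a _ walk-b) (min-b _ walk-a)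

  dist≤2 : ∀ {x y d} → Dist G x y d → d ≤ 2
  dist≤2 {x} {y} (_ , minimal) = minimal 2 (walk₂ x y)

  dist-positive : ∀ {x y d} → x ≢ y → Dist G x y d → 0 < d
  dist-positive {d = zero}  x≢y (walk , _) = ⊥-elim (x≢y (walk₀ walk))
  dist-positive {d = suc d} _   _          = s≤s z≤n

  resolves-left : ∀ x y → StronglyResolves G x x y
  resolves-left x y with dist-exists y x
  ... | d , D = inj₁ (d , d , 0 , D , D , dist-refl x , sym (+-identityʳ d))

  resolves-right : ∀ x y → StronglyResolves G y x y
  resolves-right x y with dist-exists x y
  ... | d , D = inj₂ (d , d , 0 , D , D , dist-refl y , sym (+-identityʳ d))

  resolves-by-private-neighbour : ∀ {x y z} → x ∼ y → x ∼ z → ¬ y ∼ z → z ≢ y → StronglyResolves G z x y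
  resolves-by-private-neighbour x∼y x∼z y≁z z≢y =
    inj₁ (2 , 1 , 1 , dist-nonadjacent (z≢y ∘ sym) y≁z , dist-adjacent (~-sym x∼y) , dist-adjacent x∼z , refl)

  detour-too-long : ∀ {u w a b c} → Dist G u w a → b ≡ 2 → 0 < c → a ≢ b + c
  detour-too-long u-w refl 0<c a≡2+c = <⇒≱ (+-monoʳ-≤ 2 0<c) (subst (_≤ 2) a≡2+c (dist≤2 u-w))

  nonadjacent-pair-unresolved : ∀ {x y z} → x ≢ y → ¬ x ∼ y → z ≢ x → z ≢ y →
                                ¬ StronglyResolves G z x y
  nonadjacent-pair-unresolved x≢y x≁y z≢x z≢y (inj₁ (a , b , c , y-z , y-x , x-z , a≡b+c)) =
    detour-too-long y-z (dist-unique y-x (dist-nonadjacent (x≢y ∘ sym) (x≁y ∘ ~-sym)))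
                    (dist-positive (z≢x ∘ sym) x-z) a≡b+c
  nonadjacent-pair-unresolved x≢y x≁y z≢x z≢y (inj₂ (a , b , c , x-z , x-y , y-z , a≡b+c)) =
    detour-too-long x-z (dist-unique x-y (dist-nonadjacent x≢y x≁y)) (dist-positive (z≢y ∘ sym) y-z) a≡b+c

  module _ (vs : List (V G)) (vs-unique : Unique vs) (vs-complete : ∀ x → x ∈ vs) where

    open Complement _≟_ vs vs-unique
    open import Data.List.Membership.DecPropositional _≟_ using (_∈?_)

    complement-of-resolving-is-clique : ∀ S → IsStrongResolvingSet G S → IsClique G (complement S)
    complement-of-resolving-is-clique S S-resolving {x} {y} x∈W y∈W x≢y with adjacent? x y
    ... | yes x∼y = x∼y
    ... | no x≁y with S-resolving x y x≢y
    ...   | z , z∈S , z-resolves =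
      ⊥-elim (nonadjacent-pair-unresolved x≢y x≁y (λ { refl → ∉-complement x∈W z∈S })
                                                   (λ { refl → ∉-complement y∈W z∈S }) z-resolves)

    complement-of-clique-is-resolving : ∀ W → IsClique G W →
                                        (∀ {x y} → x ∼ y → ∃[ z ] x ∼ z × ¬ y ∼ z × z ≢ y) →
                                        IsStrongResolvingSet G (complement W)
    complement-of-clique-is-resolving W W-clique private-neighbour x y x≢y with x ∈? W | y ∈? W
    ... | no x∉W  | _      = x , ∈-complement⁺ (vs-complete x) x∉W , resolves-left x y
    ... | yes _   | no y∉W = y , ∈-complement⁺ (vs-complete y) y∉W , resolves-right x y
    ... | yes x∈W | yes y∈W with private-neighbour (W-clique x∈W y∈W x≢y)
    ...   | z , x∼z , y≁z , z≢y =
      z , ∈-complement⁺ (vs-complete z) (λ z∈W → y≁z (W-clique y∈W z∈W (z≢y ∘ sym))) ,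
      resolves-by-private-neighbour (W-clique x∈W y∈W x≢y) x∼z y≁z z≢y

    strongMetricDim-order∸cliqueNumber :
      (W₀ : List (V G)) → Unique W₀ → IsClique G W₀ →
      (∀ W → Unique W → IsClique G W → length W ≤ length W₀) →
      (∀ {x y} → x ∼ y → ∃[ z ] x ∼ z × ¬ y ∼ z × z ≢ y) →
      StrongMetricDim G (length vs ∸ length W₀)
    strongMetricDim-order∸cliqueNumber W₀ W₀-unique W₀-clique W₀-maximum private-neighbour =
      (complement W₀ , complement-unique W₀ , complement-of-clique-is-resolving W₀ W₀-clique private-neighbour ,
       length-complement-W₀) ,
      λ S S-unique S-resolving → begin
        length vs ∸ length W₀
          ≡⟨ cong (_∸ length W₀) (length-complement S-unique (λ _ → vs-complete _)) ⟨
        length (complement S) + length S ∸ length W₀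
          ≤⟨ ∸-monoˡ-≤ (length W₀) (+-monoˡ-≤ (length S) (W₀-maximum _ (complement-unique S)
                                                          (complement-of-resolving-is-clique S S-resolving))) ⟩
        length W₀ + length S ∸ length W₀
          ≡⟨ m+n∸m≡n (length W₀) (length S) ⟩
        length S
          ∎
      where
      open ≤-Reasoning
      length-complement-W₀ : length (complement W₀) ≡ length vs ∸ length W₀
      length-complement-W₀ = trans (sym (m+n∸n≡m _ (length W₀)))
                                   (cong (_∸ length W₀) (length-complement W₀-unique (λ _ → vs-complete _)))

-- Modular products

module ModularProduct (G H : Graph) where

  open Graph G using () renaming (_~_ to _~ᴳ_)
  open Graph H using () renaming (_~_ to _~ᴴ_)

  ◇-sym : (∀ {a b} → a ~ᴳ b → b ~ᴳ a) → (∀ {a b} → a ~ᴴ b → b ~ᴴ a) →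
          ∀ {x y} → ModAdj G H x y → ModAdj G H y x
  ◇-sym G-sym H-sym (inj₁ (g≡g′ , h~h′))               = inj₁ (sym g≡g′ , H-sym h~h′)
  ◇-sym G-sym H-sym (inj₂ (inj₁ (g~g′ , h≡h′)))        = inj₂ (inj₁ (G-sym g~g′ , sym h≡h′))
  ◇-sym G-sym H-sym (inj₂ (inj₂ (inj₁ (g~g′ , h~h′)))) = inj₂ (inj₂ (inj₁ (G-sym g~g′ , H-sym h~h′)))
  ◇-sym G-sym H-sym (inj₂ (inj₂ (inj₂ (g≢g′ , h≢h′ , g≁g′ , h≁h′)))) =
    inj₂ (inj₂ (inj₂ (g≢g′ ∘ sym , h≢h′ ∘ sym , g≁g′ ∘ G-sym , h≁h′ ∘ H-sym)))

  ◇-irrefl : (∀ {a} → ¬ a ~ᴳ a) → (∀ {b} → ¬ b ~ᴴ b) → ∀ {x} → ¬ ModAdj G H x x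
  ◇-irrefl G-irrefl H-irrefl (inj₁ (_ , h~h))               = H-irrefl h~h
  ◇-irrefl G-irrefl H-irrefl (inj₂ (inj₁ (g~g , _)))        = G-irrefl g~g
  ◇-irrefl G-irrefl H-irrefl (inj₂ (inj₂ (inj₁ (g~g , _)))) = G-irrefl g~g
  ◇-irrefl G-irrefl H-irrefl (inj₂ (inj₂ (inj₂ (g≢g , _))))  = g≢g refl

  ◇-adjacent? : DecidableEquality (V G) → DecidableEquality (V H) →
                (∀ a b → Dec (a ~ᴳ b)) → (∀ a b → Dec (a ~ᴴ b)) → ∀ x y → Dec (ModAdj G H x y)
  ◇-adjacent? _≟ᴳ_ _≟ᴴ_ _~ᴳ?_ _~ᴴ?_ (g , h) (g′ , h′) =
    ((g ≟ᴳ g′) ×-dec (h ~ᴴ? h′)) ⊎-dec ((g ~ᴳ? g′) ×-dec (h ≟ᴴ h′)) ⊎-dec ((g ~ᴳ? g′) ×-dec (h ~ᴴ? h′)) ⊎-dec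
    (¬? (g ≟ᴳ g′) ×-dec ¬? (h ≟ᴴ h′) ×-dec ¬? (g ~ᴳ? g′) ×-dec ¬? (h ~ᴴ? h′))

  ◇-transpose : ∀ {x y} → ModAdj G H x y → ModAdj H G (swap x) (swap y)
  ◇-transpose (inj₁ (g≡g′ , h~h′))               = inj₂ (inj₁ (h~h′ , g≡g′))
  ◇-transpose (inj₂ (inj₁ (g~g′ , h≡h′)))        = inj₁ (h≡h′ , g~g′)
  ◇-transpose (inj₂ (inj₂ (inj₁ (g~g′ , h~h′)))) = inj₂ (inj₂ (inj₁ (h~h′ , g~g′)))
  ◇-transpose (inj₂ (inj₂ (inj₂ (g≢g′ , h≢h′ , g≁g′ , h≁h′)))) =
    inj₂ (inj₂ (inj₂ (h≢h′ , g≢g′ , h≁h′ , g≁g′)))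

  far×far⇒◇ : ∀ {g g′ h h′} → Far G g g′ → Far H h h′ → ModAdj G H (g , h) (g′ , h′)
  far×far⇒◇ (g≢g′ , g≁g′) (h≢h′ , h≁h′) = inj₂ (inj₂ (inj₂ (g≢g′ , h≢h′ , g≁g′ , h≁h′)))

  ◇-same-first : (∀ {a} → ¬ a ~ᴳ a) → ∀ {g h h′} → ModAdj G H (g , h) (g , h′) → h ~ᴴ h′
  ◇-same-first G-irrefl (inj₁ (_ , h~h′))               = h~h′
  ◇-same-first G-irrefl (inj₂ (inj₁ (g~g , _)))        = ⊥-elim (G-irrefl g~g)
  ◇-same-first G-irrefl (inj₂ (inj₂ (inj₁ (g~g , _)))) = ⊥-elim (G-irrefl g~g)
  ◇-same-first G-irrefl (inj₂ (inj₂ (inj₂ (g≢g , _))))  = ⊥-elim (g≢g refl)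

  ◇-adjacent-first : (∀ {a} → ¬ a ~ᴳ a) → ∀ {g g′ h h′} → g ~ᴳ g′ → ModAdj G H (g , h) (g′ , h′) →
                     Close H h h′
  ◇-adjacent-first G-irrefl g~g′ (inj₁ (refl , _))                       = ⊥-elim (G-irrefl g~g′)
  ◇-adjacent-first G-irrefl g~g′ (inj₂ (inj₁ (_ , h≡h′)))                = inj₁ h≡h′
  ◇-adjacent-first G-irrefl g~g′ (inj₂ (inj₂ (inj₁ (_ , h~h′))))         = inj₂ h~h′
  ◇-adjacent-first G-irrefl g~g′ (inj₂ (inj₂ (inj₂ (_ , _ , g≁g′ , _)))) = ⊥-elim (g≁g′ g~g′)

  ◇-far-first : ∀ {g g′ h h′} → Far G g g′ → ModAdj G H (g , h) (g′ , h′) → Far H h h′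
  ◇-far-first (g≢g′ , _) (inj₁ (g≡g′ , _))                          = ⊥-elim (g≢g′ g≡g′)
  ◇-far-first (_ , g≁g′) (inj₂ (inj₁ (g~g′ , _)))                   = ⊥-elim (g≁g′ g~g′)
  ◇-far-first (_ , g≁g′) (inj₂ (inj₂ (inj₁ (g~g′ , _))))            = ⊥-elim (g≁g′ g~g′)
  ◇-far-first _          (inj₂ (inj₂ (inj₂ (_ , h≢h′ , _ , h≁h′)))) = h≢h′ , h≁h′

module _ (G H : Graph) where

  open ModularProduct G H

  ◇-far-second : ∀ {g g′ h h′} → Far H h h′ → ModAdj G H (g , h) (g′ , h′) → Far G g g′
  ◇-far-second h⋯h′ x~y = ModularProduct.◇-far-first H G h⋯h′ (◇-transpose x~y)

  ◇-walk₂ : (∀ {a b} → _~_ G a b → _~_ G b a) → (∀ {a b} → _~_ H a b → _~_ H b a) →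
            (∀ a b → ∃[ c ] Far G a c × Far G b c) → (∀ a b → ∃[ c ] Far H a c × Far H b c) →
            ∀ x y → Walk (G ◇ H) x y 2
  ◇-walk₂ G-sym H-sym G-far H-far (g , h) (g′ , h′) with G-far g g′ | H-far h h′
  ... | u , g⋯u , g′⋯u | v , h⋯v , h′⋯v =
    there (far×far⇒◇ g⋯u h⋯v) (there (far×far⇒◇ (far-sym G G-sym g′⋯u) (far-sym H H-sym h′⋯v)) here)

  -- z is far from x in both coordinates, while against y one coordinate of z is far and the other close.
  ◇-private-neighbour :
    (∀ {a} → ¬ _~_ G a a) →
    (∀ a b → ∃[ c ] Far G a c × Far G b c) → (∀ a b → ∃[ c ] Far H a c × Far H b c) →
    (∀ {a b} → _~_ G a b → ∃[ c ] _~_ G b c × Far G a c) →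
    (∀ {a b} → _~_ H a b → ∃[ c ] _~_ H b c × Far H a c) →
    ∀ {x y} → ModAdj G H x y → ∃[ z ] ModAdj G H x z × ¬ ModAdj G H y z × z ≢ y
  ◇-private-neighbour _ G-far _ _ H-extend {g , h} (inj₁ (refl , h~h′))
    with H-extend h~h′ | G-far g g
  ... | v , h′~v , h⋯v | u , g⋯u , _ =
    (u , v) , far×far⇒◇ g⋯u h⋯v , (λ y~z → proj₂ (◇-far-first g⋯u y~z) h′~v) ,
    proj₁ g⋯u ∘ sym ∘ cong proj₁
  ◇-private-neighbour _ _ H-far G-extend _ {g , h} (inj₂ (inj₁ (g~g′ , refl)))
    with G-extend g~g′ | H-far h h
  ... | v , g′~v , g⋯v | u , h⋯u , _ =
    (v , u) , far×far⇒◇ g⋯v h⋯u , (λ y~z → proj₂ (◇-far-second h⋯u y~z) g′~v) ,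
    proj₁ h⋯u ∘ sym ∘ cong proj₂
  ◇-private-neighbour _ G-far _ _ H-extend {g , h} {g′ , _} (inj₂ (inj₂ (inj₁ (g~g′ , h~h′))))
    with H-extend h~h′ | G-far g g′
  ... | v , h′~v , h⋯v | u , g⋯u , g′⋯u =
    (u , v) , far×far⇒◇ g⋯u h⋯v , (λ y~z → proj₂ (◇-far-first g′⋯u y~z) h′~v) ,
    proj₁ g′⋯u ∘ sym ∘ cong proj₁
  ◇-private-neighbour G-irrefl _ H-far _ _ {g , h} {g′ , h′} (inj₂ (inj₂ (inj₂ (g≢g′ , _ , g≁g′ , _))))
    with H-far h h′
  ... | v , h⋯v , h′⋯v =
    (g′ , v) , far×far⇒◇ (g≢g′ , g≁g′) h⋯v , (λ y~z → proj₂ h′⋯v (◇-same-first G-irrefl y~z)) ,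
    proj₁ h′⋯v ∘ sym ∘ cong proj₂

  transpose-clique : ∀ {W} → IsClique (G ◇ H) W → IsClique (H ◇ G) (map swap W)
  transpose-clique W-clique x∈ y∈ x≢y with ∈-map⁻ swap x∈ | ∈-map⁻ swap y∈
  ... | _ , x∈W , refl | _ , y∈W , refl = ◇-transpose (W-clique x∈W y∈W (x≢y ∘ cong swap))

transpose-unique : ∀ {A B : Set} {W : List (A × B)} → Unique W → Unique (map swap W)
transpose-unique = Unique.map⁺ (cong swap)

-- Cycles

-- Cancelling x by adding its inverse n ∸ x % n.
%-cancelʳ-+ : ∀ {n} .{{_ : NonZero n}} a b x → (a + x) % n ≡ (b + x) % n → a % n ≡ b % n
%-cancelʳ-+ {n} a b x eq = begin
  a % n                       ≡⟨ %-remove-+ʳ a n∣x+x⁻ ⟨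
  (a + (x + x⁻)) % n          ≡⟨ cong (_% n) (+-assoc a x x⁻) ⟨
  (a + x + x⁻) % n            ≡⟨ %-distribˡ-+ (a + x) x⁻ n ⟩
  ((a + x) % n + x⁻ % n) % n  ≡⟨ cong (λ y → (y + x⁻ % n) % n) eq ⟩
  ((b + x) % n + x⁻ % n) % n  ≡⟨ %-distribˡ-+ (b + x) x⁻ n ⟨
  (b + x + x⁻) % n            ≡⟨ cong (_% n) (+-assoc b x x⁻) ⟩
  (b + (x + x⁻)) % n          ≡⟨ %-remove-+ʳ b n∣x+x⁻ ⟩
  b % n                       ∎
  where
  open ≡-Reasoning
  x⁻ = n ∸ x % n
  x+x⁻≡ : x + x⁻ ≡ n + x / n * n
  x+x⁻≡ = begin
    x + x⁻                    ≡⟨ cong (_+ x⁻) (m≡m%n+[m/n]*n x n) ⟩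
    x % n + x / n * n + x⁻    ≡⟨ +-assoc (x % n) _ x⁻ ⟩
    x % n + (x / n * n + x⁻)  ≡⟨ cong (x % n +_) (+-comm _ x⁻) ⟩
    x % n + (x⁻ + x / n * n)  ≡⟨ +-assoc (x % n) x⁻ _ ⟨
    x % n + x⁻ + x / n * n    ≡⟨ cong (_+ x / n * n) (m+[n∸m]≡n (m%n≤n x n)) ⟩
    n + x / n * n             ∎
  n∣x+x⁻ : n ∣ x + x⁻
  n∣x+x⁻ = subst (n ∣_) (sym x+x⁻≡) (n∣m*n (suc (x / n)))

[m+n%d]%d≡[m+n]%d : ∀ m n d .{{_ : NonZero d}} → (m + n % d) % d ≡ (m + n) % d
[m+n%d]%d≡[m+n]%d m n d = begin
  (m + n % d) % d          ≡⟨ %-distribˡ-+ m (n % d) d ⟩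
  (m % d + n % d % d) % d  ≡⟨ cong (λ x → (m % d + x) % d) (m%n%n≡m%n n d) ⟩
  (m % d + n % d) % d      ≡⟨ %-distribˡ-+ m n d ⟨
  (m + n) % d              ∎
  where open ≡-Reasoning

module CycleGeometry (n : ℕ) .{{_ : NonZero n}} where

  private
    C = Cycle n

  ⟦_⟧ : ℕ → Fin n
  ⟦ a ⟧ = fromℕ< (m%n<n a n)

  toℕ-⟦⟧ : ∀ a → toℕ ⟦ a ⟧ ≡ a % n
  toℕ-⟦⟧ a = toℕ-fromℕ< (m%n<n a n)

  ⟦⟧-≡ : ∀ {a b} → a % n ≡ b % n → ⟦ a ⟧ ≡ ⟦ b ⟧
  ⟦⟧-≡ {a} {b} eq = toℕ-injective (trans (toℕ-⟦⟧ a) (trans eq (sym (toℕ-⟦⟧ b))))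

  ⟦toℕ⟧ : ∀ v → ⟦ toℕ v ⟧ ≡ v
  ⟦toℕ⟧ v = toℕ-injective (trans (toℕ-⟦⟧ (toℕ v)) (m<n⇒m%n≡m (toℕ<n v)))

  ⟦⟧-periodic : ∀ a → ⟦ a + n ⟧ ≡ ⟦ a ⟧
  ⟦⟧-periodic a = ⟦⟧-≡ ([m+n]%n≡m%n a n)

  _⊕_ : Fin n → ℕ → Fin n
  v ⊕ k = ⟦ k + toℕ v ⟧

  ⟦⟧-⊕ : ∀ a k → ⟦ a ⟧ ⊕ k ≡ ⟦ k + a ⟧
  ⟦⟧-⊕ a k = ⟦⟧-≡ (trans (cong (λ x → (k + x) % n) (toℕ-⟦⟧ a)) ([m+n%d]%d≡[m+n]%d k a n))

  ⊕-assoc : ∀ v k l → (v ⊕ k) ⊕ l ≡ v ⊕ (l + k)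
  ⊕-assoc v k l = trans (⟦⟧-⊕ (k + toℕ v) l) (cong ⟦_⟧ (sym (+-assoc l k (toℕ v))))

  ⊕-identity : ∀ v → v ⊕ 0 ≡ v
  ⊕-identity = ⟦toℕ⟧

  ⊕-period : ∀ v → v ⊕ n ≡ v
  ⊕-period v = trans (cong ⟦_⟧ (+-comm n (toℕ v))) (trans (⟦⟧-periodic (toℕ v)) (⟦toℕ⟧ v))

  ⊕-cancel : ∀ v {k l} → k < n → l < n → v ⊕ k ≡ v ⊕ l → k ≡ l
  ⊕-cancel v {k} {l} k<n l<n eq = begin
    k      ≡⟨ m<n⇒m%n≡m k<n ⟨
    k % n  ≡⟨ %-cancelʳ-+ k l (toℕ v) (trans (sym (toℕ-⟦⟧ _)) (trans (cong toℕ eq) (toℕ-⟦⟧ _))) ⟩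
    l % n  ≡⟨ m<n⇒m%n≡m l<n ⟩
    l      ∎
    where open ≡-Reasoning

  ⊕-injective : ∀ {u v} k → u ⊕ k ≡ v ⊕ k → u ≡ v
  ⊕-injective {u} {v} k eq = toℕ-injective (begin
    toℕ u            ≡⟨ m<n⇒m%n≡m (toℕ<n u) ⟨
    toℕ u % n        ≡⟨ %-cancelʳ-+ (toℕ u) (toℕ v) k (begin
      (toℕ u + k) % n  ≡⟨ cong (_% n) (+-comm (toℕ u) k) ⟩
      (k + toℕ u) % n  ≡⟨ toℕ-⟦⟧ _ ⟨
      toℕ (u ⊕ k)      ≡⟨ cong toℕ eq ⟩
      toℕ (v ⊕ k)      ≡⟨ toℕ-⟦⟧ _ ⟩
      (k + toℕ v) % n  ≡⟨ cong (_% n) (+-comm k (toℕ v)) ⟩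
      (toℕ v + k) % n  ∎) ⟩
    toℕ v % n        ≡⟨ m<n⇒m%n≡m (toℕ<n v) ⟩
    toℕ v            ∎)
    where open ≡-Reasoning

  predecessor : ∀ v → ∃[ w ] w ⊕ 1 ≡ v
  predecessor v = v ⊕ (n ∸ 1) ,
                  trans (⊕-assoc v (n ∸ 1) 1) (trans (cong (v ⊕_) (m+[n∸m]≡n (>-nonZero⁻¹ n))) (⊕-period v))

  adjacent-sym : ∀ {u v} → CycleAdj n u v → CycleAdj n v u
  adjacent-sym (inj₁ e)               = inj₂ (inj₁ e)
  adjacent-sym (inj₂ (inj₁ e))        = inj₁ e
  adjacent-sym (inj₂ (inj₂ (inj₁ e))) = inj₂ (inj₂ (inj₂ e))
  adjacent-sym (inj₂ (inj₂ (inj₂ e))) = inj₂ (inj₂ (inj₁ e))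

  adjacent-irrefl : 2 ≤ n → ∀ {v} → ¬ CycleAdj n v v
  adjacent-irrefl 2≤n (inj₁ e)                      = 1+n≢n (sym e)
  adjacent-irrefl 2≤n (inj₂ (inj₁ e))               = 1+n≢n (sym e)
  adjacent-irrefl 2≤n (inj₂ (inj₂ (inj₁ (e , e′)))) = <⇒≢ 2≤n (trans (cong suc (sym e)) e′)
  adjacent-irrefl 2≤n (inj₂ (inj₂ (inj₂ (e , e′)))) = <⇒≢ 2≤n (trans (cong suc (sym e)) e′)

  adjacent? : ∀ u v → Dec (CycleAdj n u v)
  adjacent? u v = (toℕ v ≟ suc (toℕ u)) ⊎-dec (toℕ u ≟ suc (toℕ v)) ⊎-dec
                  ((toℕ u ≟ 0) ×-dec (suc (toℕ v) ≟ n)) ⊎-dec ((toℕ v ≟ 0) ×-dec (suc (toℕ u) ≟ n))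

  ⊕1-adjacent : ∀ v → CycleAdj n v (v ⊕ 1)
  ⊕1-adjacent v with suc (toℕ v) <? n
  ... | yes 1+v<n = inj₁ (trans (toℕ-⟦⟧ (suc (toℕ v))) (m<n⇒m%n≡m 1+v<n))
  ... | no 1+v≮n  =
    inj₂ (inj₂ (inj₂ (trans (toℕ-⟦⟧ (suc (toℕ v))) (trans (cong (_% n) 1+v≡n) (n%n≡0 n)) , 1+v≡n)))
    where
    1+v≡n : suc (toℕ v) ≡ n
    1+v≡n = ≤-antisym (toℕ<n v) (≮⇒≥ 1+v≮n)

  adjacent⇒⊕1 : ∀ {u v} → CycleAdj n u v → v ≡ u ⊕ 1 ⊎ u ≡ v ⊕ 1
  adjacent⇒⊕1 {u} {v} (inj₁ v≡1+u)        = inj₁ (sym (trans (cong ⟦_⟧ (sym v≡1+u)) (⟦toℕ⟧ v)))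
  adjacent⇒⊕1 {u} {v} (inj₂ (inj₁ u≡1+v)) = inj₂ (sym (trans (cong ⟦_⟧ (sym u≡1+v)) (⟦toℕ⟧ u)))
  adjacent⇒⊕1 {u} {v} (inj₂ (inj₂ (inj₁ (u≡0 , 1+v≡n)))) =
    inj₂ (toℕ-injective (trans u≡0 (sym (trans (toℕ-⟦⟧ _) (trans (cong (_% n) 1+v≡n) (n%n≡0 n))))))
  adjacent⇒⊕1 {u} {v} (inj₂ (inj₂ (inj₂ (v≡0 , 1+u≡n)))) =
    inj₁ (toℕ-injective (trans v≡0 (sym (trans (toℕ-⟦⟧ _) (trans (cong (_% n) 1+u≡n) (n%n≡0 n))))))

  far-⊕ : ∀ j → 4 + j ≤ n → ∀ v → Far C v (v ⊕ (2 + j))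
  far-⊕ j 4+j≤n v = v≢v⊕k , v≁v⊕k
    where
    k<n : 2 + j < n
    k<n = ≤-trans (n≤1+n _) 4+j≤n
    v≢v⊕k : v ≢ v ⊕ (2 + j)
    v≢v⊕k v≡v⊕k = 0≢1+n (⊕-cancel v (≤-trans (s≤s z≤n) k<n) k<n (trans (⊕-identity v) v≡v⊕k))
    v≁v⊕k : ¬ CycleAdj n v (v ⊕ (2 + j))
    v≁v⊕k v~v⊕k with adjacent⇒⊕1 v~v⊕k
    ... | inj₁ v⊕k≡v⊕1 = 1+n≢0 (suc-injective (⊕-cancel v k<n (≤-trans (s≤s (s≤s z≤n)) k<n) v⊕k≡v⊕1))
    ... | inj₂ v≡v⊕k⊕1 = 0≢1+n (⊕-cancel v (≤-trans (s≤s z≤n) k<n) 4+j≤n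
                            (trans (⊕-identity v) (trans v≡v⊕k⊕1 (⊕-assoc v (2 + j) 1))))

  close-to-⊕1-pair : 4 ≤ n → ∀ {p a} → Close C a p → Close C a (p ⊕ 1) → a ≡ p ⊎ a ≡ p ⊕ 1
  close-to-⊕1-pair _ (inj₁ a≡p) _ = inj₁ a≡p
  close-to-⊕1-pair 4≤n {p} {a} (inj₂ a~p) a≈p⊕1 with adjacent⇒⊕1 a~p | a≈p⊕1
  ... | inj₂ a≡p⊕1 | _          = inj₂ a≡p⊕1
  ... | inj₁ _     | inj₁ a≡p⊕1 = inj₂ a≡p⊕1
  ... | inj₁ p≡a⊕1 | inj₂ a~p⊕1 with adjacent⇒⊕1 a~p⊕1
  ...   | inj₁ p⊕1≡a⊕1 = ⊥-elim (0≢1+n (⊕-cancel p (≤-trans (s≤s z≤n) 4≤n) (≤-trans (m≤m+n 2 2) 4≤n) (begin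
    p ⊕ 0              ≡⟨ ⊕-identity p ⟩
    p                  ≡⟨ p≡a⊕1 ⟩
    a ⊕ 1              ≡⟨ p⊕1≡a⊕1 ⟨
    p ⊕ 1              ∎)))
    where open ≡-Reasoning
  ...   | inj₂ a≡p⊕1⊕1 = ⊥-elim (0≢1+n (⊕-cancel p (≤-trans (s≤s z≤n) 4≤n) 4≤n (begin
    p ⊕ 0              ≡⟨ ⊕-identity p ⟩
    p                  ≡⟨ p≡a⊕1 ⟩
    a ⊕ 1              ≡⟨ cong (_⊕ 1) a≡p⊕1⊕1 ⟩
    ((p ⊕ 1) ⊕ 1) ⊕ 1  ≡⟨ cong (_⊕ 1) (⊕-assoc p 1 1) ⟩
    (p ⊕ 2) ⊕ 1        ≡⟨ ⊕-assoc p 2 1 ⟩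
    p ⊕ 3              ∎)))
    where open ≡-Reasoning

  close-to-adjacent-pair : 4 ≤ n → ∀ {p q a} → CycleAdj n p q → Close C a p → Close C a q → a ≡ p ⊎ a ≡ q
  close-to-adjacent-pair 4≤n p~q a≈p a≈q with adjacent⇒⊕1 p~q
  ... | inj₁ refl = close-to-⊕1-pair 4≤n a≈p a≈q
  ... | inj₂ refl = Sum.swap (close-to-⊕1-pair 4≤n a≈q a≈p)

  triangle-free : 4 ≤ n → ∀ {u v w} → CycleAdj n u v → CycleAdj n u w → CycleAdj n v w → ⊥
  triangle-free 4≤n u~v u~w v~w
    with close-to-adjacent-pair 4≤n u~v (inj₂ (adjacent-sym u~w)) (inj₂ (adjacent-sym v~w))
  ... | inj₁ refl = adjacent-irrefl (≤-trans (s≤s (s≤s z≤n)) 4≤n) u~w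
  ... | inj₂ refl = adjacent-irrefl (≤-trans (s≤s (s≤s z≤n)) 4≤n) v~w

  -- If v is close to u ⊕ 2, then it lies in u ⊕ {1, 2, 3}, so u ⊕ 5 is far from both.
  far-from-both : 7 ≤ n → ∀ u v → ∃[ w ] Far C u w × Far C v w
  far-from-both 7≤n u v = choose ((v ≟ᶠ u ⊕ 2) ⊎-dec adjacent? v (u ⊕ 2))
    where
    far-⊕≤5 : ∀ j → j ≤ 3 → ∀ w → Far C w (w ⊕ (2 + j))
    far-⊕≤5 j j≤3 = far-⊕ j (≤-trans (+-monoʳ-≤ 4 j≤3) 7≤n)

    far-from-v : Close C v (u ⊕ 2) → Far C v (u ⊕ 5)
    far-from-v (inj₁ refl) = subst (Far C v) (⊕-assoc u 2 3) (far-⊕≤5 1 (s≤s z≤n) v)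
    far-from-v (inj₂ v~u⊕2) with adjacent⇒⊕1 v~u⊕2
    ... | inj₁ u⊕2≡v⊕1 =
      subst (Far C v) (trans (sym (⊕-assoc v 1 3)) (trans (cong (_⊕ 3) (sym u⊕2≡v⊕1)) (⊕-assoc u 2 3)))
            (far-⊕≤5 2 (s≤s (s≤s z≤n)) v)
    ... | inj₂ v≡u⊕2⊕1 =
      subst (Far C v) (trans (cong (_⊕ 2) (trans v≡u⊕2⊕1 (⊕-assoc u 2 1))) (⊕-assoc u 3 2)) (far-⊕≤5 0 z≤n v)

    choose : Dec (Close C v (u ⊕ 2)) → ∃[ w ] Far C u w × Far C v w
    choose (no v≉u⊕2)  = u ⊕ 2 , far-⊕≤5 0 z≤n u , v≉u⊕2 ∘ inj₁ , v≉u⊕2 ∘ inj₂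
    choose (yes v≈u⊕2) = u ⊕ 5 , far-⊕≤5 3 ≤-refl u , far-from-v v≈u⊕2

  adjacent-far-extension : 4 ≤ n → ∀ {u v} → CycleAdj n u v → ∃[ w ] CycleAdj n v w × Far C u w
  adjacent-far-extension 4≤n {u} u~v with adjacent⇒⊕1 u~v
  ... | inj₁ refl = u ⊕ 2 , subst (CycleAdj n (u ⊕ 1)) (⊕-assoc u 1 1) (⊕1-adjacent (u ⊕ 1)) , far-⊕ 0 4≤n u
  adjacent-far-extension 4≤n {_} {v} u~v | inj₂ refl with predecessor v
  ... | w , w⊕1≡v =
    w , subst (λ x → CycleAdj n x w) w⊕1≡v (adjacent-sym (⊕1-adjacent w)) ,
    subst (λ x → Far C x w) (trans (sym (⊕-assoc w 1 1)) (cong (_⊕ 1) w⊕1≡v))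
          (far-sym C adjacent-sym (far-⊕ 0 4≤n w))

  ⟦⟧-adjacent : ∀ a → CycleAdj n ⟦ a ⟧ ⟦ suc a ⟧
  ⟦⟧-adjacent a = subst (CycleAdj n ⟦ a ⟧) (⟦⟧-⊕ a 1) (⊕1-adjacent ⟦ a ⟧)

  adjacent-⟦suc⟧ : ∀ {v} a → CycleAdj n v ⟦ suc a ⟧ → v ≡ ⟦ a ⟧ ⊎ v ≡ ⟦ suc (suc a) ⟧
  adjacent-⟦suc⟧ a v~a+1 with adjacent⇒⊕1 v~a+1
  ... | inj₁ a+1≡v⊕1 = inj₁ (⊕-injective 1 (trans (sym a+1≡v⊕1) (sym (⟦⟧-⊕ a 1))))
  ... | inj₂ v≡a+1⊕1 = inj₂ (trans v≡a+1⊕1 (⟦⟧-⊕ (suc a) 1))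

  ⟦⟧-far : ∀ {a b} → a + 2 ≤ b → b + 2 ≤ a + n → Far C ⟦ a ⟧ ⟦ b ⟧
  ⟦⟧-far {a} a+2≤b b+2≤a+n with m≤n⇒∃[o]m+o≡n a+2≤b
  ... | j , refl = subst (Far C ⟦ a ⟧) (trans (⟦⟧-⊕ a (2 + j)) (cong ⟦_⟧ (rearrange′ a j)))
                         (far-⊕ j (+-cancelʳ-≤ a (4 + j) n (begin
                           4 + j + a      ≡⟨ rearrange a j ⟩
                           a + 2 + j + 2  ≤⟨ b+2≤a+n ⟩
                           a + n          ≡⟨ +-comm a n ⟩
                           n + a          ∎)) ⟦ a ⟧)
    where
    open ≤-Reasoning
    rearrange : ∀ a j → 4 + j + a ≡ a + 2 + j + 2
    rearrange = solve-∀
    rearrange′ : ∀ a j → 2 + j + a ≡ a + 2 + j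
    rearrange′ = solve-∀

-- Windows of a cyclic sequence

triple≤4 : ∀ {x y z} → x ≤ 2 → y ≤ 2 → z ≤ 2 →
           (0 < x → 0 < y → 0 < z → x ≤ 1 × y ≤ 1 × z ≤ 1) → x + y + z ≤ 4
triple≤4 {zero}                  _   y≤2 z≤2 _ = +-mono-≤ y≤2 z≤2
triple≤4 {suc _} {zero}          x≤2 _   z≤2 _ = +-mono-≤ (+-monoˡ-≤ 0 x≤2) z≤2
triple≤4 {suc _} {suc _} {zero}  x≤2 y≤2 _   _ = +-monoˡ-≤ 0 (+-mono-≤ x≤2 y≤2)
triple≤4 {suc _} {suc _} {suc _} _   _   _   runs with runs (s≤s z≤n) (s≤s z≤n) (s≤s z≤n)
... | x≤1 , y≤1 , z≤1 = m≤n⇒m≤1+n (+-mono-≤ (+-mono-≤ x≤1 y≤1) z≤1)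

triple-with-one≤3 : ∀ {x y z} → x ≤ 2 → y ≤ 2 → z ≤ 2 →
                    (0 < x → 0 < y → 0 < z → x ≤ 1 × y ≤ 1 × z ≤ 1) →
                    x ≡ 1 ⊎ y ≡ 1 ⊎ z ≡ 1 → x + y + z ≤ 3
triple-with-one≤3 {zero}  _ _   z≤2 _ (inj₂ (inj₁ refl)) = s≤s z≤2
triple-with-one≤3 {zero}  _ y≤2 _   _ (inj₂ (inj₂ refl)) = +-monoˡ-≤ 1 y≤2
triple-with-one≤3 {suc _} {zero} _ _ z≤2 _ (inj₁ refl) = s≤s z≤2
triple-with-one≤3 {suc _} {zero} (s≤s x≤1) _ _ _ (inj₂ (inj₂ refl)) = s≤s (+-monoˡ-≤ 1 (+-monoˡ-≤ 0 x≤1))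
triple-with-one≤3 {suc _} {suc _} {zero} _ (s≤s y≤1) _ _ (inj₁ refl) = s≤s (s≤s (+-monoˡ-≤ 0 y≤1))
triple-with-one≤3 {suc _} {suc _} {zero} (s≤s x≤1) _ _ _ (inj₂ (inj₁ refl)) = s≤s (+-monoˡ-≤ 0 (+-monoˡ-≤ 1 x≤1))
triple-with-one≤3 {suc _} {suc _} {suc _} _ _ _ runs _ with runs (s≤s z≤n) (s≤s z≤n) (s≤s z≤n)
... | x≤1 , y≤1 , z≤1 = +-mono-≤ (+-mono-≤ x≤1 y≤1) z≤1

≤2∧≢1⇒2∣ : ∀ {x} → x ≤ 2 → x ≢ 1 → 2 ∣ x
≤2∧≢1⇒2∣ z≤n                 _   = 2 ∣0
≤2∧≢1⇒2∣ (s≤s z≤n)           x≢1 = contradiction refl x≢1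
≤2∧≢1⇒2∣ (s≤s (s≤s z≤n))     _   = ∣-refl

≤1∧≢1⇒≡0 : ∀ {x} → x ≤ 1 → x ≢ 1 → x ≡ 0
≤1∧≢1⇒≡0 z≤n       _   = refl
≤1∧≢1⇒≡0 (s≤s z≤n) x≢1 = contradiction refl x≢1

sides-vanish : ∀ {x y z} → x + y + z ≤ 2 → 2 ≤ y → x ≡ 0 × z ≡ 0
sides-vanish {x} {y} {z} sum≤2 2≤y =
  n≤0⇒n≡0 (≤-trans (m≤m+n x z) x+z≤0) , n≤0⇒n≡0 (≤-trans (m≤n+m z x) x+z≤0)
  where
  x+z≤0 : x + z ≤ 0
  x+z≤0 = +-cancelʳ-≤ 2 (x + z) 0 (begin
    x + z + 2     ≡⟨ +-comm (x + z) 2 ⟩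
    2 + (x + z)   ≤⟨ +-monoˡ-≤ (x + z) 2≤y ⟩
    y + (x + z)   ≡⟨ rearrange y x z ⟩
    x + y + z     ≤⟨ sum≤2 ⟩
    2             ∎)
    where
    open ≤-Reasoning
    rearrange : ∀ y x z → y + (x + z) ≡ x + y + z
    rearrange = solve-∀

isolated-middle : ∀ {x₀ x₁ x₂ x₃ x₄} → x₀ ≤ 2 → x₄ ≤ 2 → x₁ ≢ 1 → x₂ ≢ 1 → x₃ ≢ 1 →
                  4 ≤ x₀ + x₁ + x₂ → x₁ + x₂ + x₃ < 4 → 4 ≤ x₂ + x₃ + x₄ →
                  x₁ ≡ 0 × 0 < x₂ × x₃ ≡ 0
isolated-middle {x₀} {x₁} {zero} {x₃} x₀≤2 x₄≤2 _ _ _ left middle right = contradiction middle (≤⇒≯ (begin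
  4               ≤⟨ +-mono-≤ 2≤x₁ 2≤x₃ ⟩
  x₁ + x₃         ≡⟨ cong (_+ x₃) (+-identityʳ x₁) ⟨
  x₁ + 0 + x₃     ∎))
  where
  open ≤-Reasoning
  2≤x₁ : 2 ≤ x₁
  2≤x₁ = +-cancelˡ-≤ 2 2 x₁ (≤-trans left (≤-trans (≤-reflexive (+-identityʳ (x₀ + x₁))) (+-monoˡ-≤ x₁ x₀≤2)))
  2≤x₃ : 2 ≤ x₃
  2≤x₃ = +-cancelʳ-≤ 2 2 x₃ (≤-trans right (+-monoʳ-≤ x₃ x₄≤2))
isolated-middle {x₂ = suc zero} _ _ _ x₂≢1 _ _ _ _ = contradiction refl x₂≢1
isolated-middle {x₀} {x₁} {suc (suc y)} {x₃} _ _ x₁≢1 _ x₃≢1 _ middle _ =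
  ≤1∧≢1⇒≡0 (≤-trans (m≤m+n x₁ x₃) x₁+x₃≤1) x₁≢1 , s≤s z≤n ,
  ≤1∧≢1⇒≡0 (≤-trans (m≤n+m x₃ x₁) x₁+x₃≤1) x₃≢1
  where
  open ≤-Reasoning
  x₁+x₃≤1 : x₁ + x₃ ≤ 1
  x₁+x₃≤1 = ≤-pred (≤-pred (≤-pred (begin
    suc (suc (suc (x₁ + x₃)))        ≤⟨ s≤s (s≤s (s≤s (+-monoˡ-≤ x₃ (m≤m+n x₁ y)))) ⟩
    suc (suc (suc (x₁ + y + x₃)))    ≡⟨ cong suc (rearrange x₁ y x₃) ⟩
    suc (x₁ + suc (suc y) + x₃)      ≤⟨ middle ⟩
    4                                ∎)))
    where
    rearrange : ∀ a b c → suc (suc (a + b + c)) ≡ a + suc (suc b) + c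
    rearrange = solve-∀

module CyclicWindows
  (n : ℕ) (3≤n : 3 ≤ n) (c : ℕ → ℕ)
  (c-periodic : ∀ i → c (i + n) ≡ c i)
  (c≤2 : ∀ i → c i ≤ 2)
  (c-runs : ∀ i → 0 < c i → 0 < c (suc i) → 0 < c (suc (suc i)) →
            c i ≤ 1 × c (suc i) ≤ 1 × c (suc (suc i)) ≤ 1)
  where

  window : ℕ → ℕ
  window i = c i + c (suc i) + c (suc (suc i))

  window≤4 : ∀ i → window i ≤ 4
  window≤4 i = triple≤4 (c≤2 i) (c≤2 (suc i)) (c≤2 (suc (suc i))) (c-runs i)

  deficit : ℕ → ℕ
  deficit i = 4 ∸ window i

  defect : ℕ
  defect = ∑< n deficit

  deficit-periodic : ∀ i → deficit (i + n) ≡ deficit i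
  deficit-periodic i =
    cong (4 ∸_) (cong₂ _+_ (cong₂ _+_ (c-periodic i) (c-periodic (suc i))) (c-periodic (suc (suc i))))

  defect-equation : 3 * ∑< n c + defect ≡ 4 * n
  defect-equation = begin
    3 * ∑< n c + defect                      ≡⟨ cong (_+ defect) ∑window≡3*∑c ⟨
    ∑< n window + ∑< n deficit               ≡⟨ ∑-distrib-+ n window deficit ⟨
    ∑[ i < n ] (window i + deficit i)        ≡⟨ ∑-cong n (λ i _ → m+[n∸m]≡n (window≤4 i)) ⟩
    ∑[ i < n ] 4                             ≡⟨ ∑-const n 4 ⟩
    n * 4                                    ≡⟨ *-comm n 4 ⟩
    4 * n                                    ∎
    where
    open ≡-Reasoning
    ∑window≡3*∑c : ∑< n window ≡ 3 * ∑< n c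
    ∑window≡3*∑c = begin
      ∑< n window
        ≡⟨ ∑-distrib-+ n _ (c ∘ suc ∘ suc) ⟩
      ∑[ i < n ] (c i + c (suc i)) + ∑< n (c ∘ suc ∘ suc)
        ≡⟨ cong (_+ ∑< n (c ∘ suc ∘ suc)) (∑-distrib-+ n c (c ∘ suc)) ⟩
      ∑< n c + ∑< n (c ∘ suc) + ∑< n (c ∘ suc ∘ suc)
        ≡⟨ cong₂ (λ x y → ∑< n c + x + y) ∑c∘suc ∑c∘suc∘suc ⟩
      ∑< n c + ∑< n c + ∑< n c
        ≡⟨ x+x+x≡3x (∑< n c) ⟩
      3 * ∑< n c
        ∎
      where
      ∑c∘suc : ∑< n (c ∘ suc) ≡ ∑< n c
      ∑c∘suc = ∑-shift n c (c-periodic 0)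
      ∑c∘suc∘suc : ∑< n (c ∘ suc ∘ suc) ≡ ∑< n c
      ∑c∘suc∘suc = trans (∑-shift n (c ∘ suc) (c-periodic 1)) ∑c∘suc
      x+x+x≡3x : ∀ x → x + x + x ≡ 3 * x
      x+x+x≡3x = solve-∀

  consecutive-deficits≤defect : ∀ b → deficit b + deficit (suc b) + deficit (suc (suc b)) ≤ defect
  consecutive-deficits≤defect = ∑-consecutive-three deficit deficit-periodic 3≤n

  deficit≥1 : ∀ {i} → window i ≤ 3 → 1 ≤ deficit i
  deficit≥1 w≤3 = m<n⇒0<n∸m (s≤s w≤3)

  defect≥3 : ∀ {j} → c j ≡ 1 → 3 ≤ defect
  defect≥3 {j} cj≡1 = ≤-trans (+-mono-≤ (+-mono-≤ (deficit≥1 w₀≤3) (deficit≥1 w₁≤3)) (deficit≥1 w₂≤3))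
                              (consecutive-deficits≤defect b)
    where
    b = (n ∸ 2) + j
    c[2+b]≡1 : c (suc (suc b)) ≡ 1
    c[2+b]≡1 = begin
      c (suc (suc (n ∸ 2)) + j) ≡⟨ cong (λ m → c (m + j)) (m+[n∸m]≡n (≤-trans (n≤1+n 2) 3≤n)) ⟩
      c (n + j)                 ≡⟨ cong c (+-comm n j) ⟩
      c (j + n)                 ≡⟨ c-periodic j ⟩
      c j                       ≡⟨ cj≡1 ⟩
      1                         ∎
      where open ≡-Reasoning
    window≤3 : ∀ i → c i ≡ 1 ⊎ c (suc i) ≡ 1 ⊎ c (suc (suc i)) ≡ 1 → window i ≤ 3
    window≤3 i = triple-with-one≤3 (c≤2 i) (c≤2 (suc i)) (c≤2 (suc (suc i))) (c-runs i)
    w₀≤3 = window≤3 b (inj₂ (inj₂ c[2+b]≡1))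
    w₁≤3 = window≤3 (suc b) (inj₂ (inj₁ c[2+b]≡1))
    w₂≤3 = window≤3 (suc (suc b)) (inj₁ c[2+b]≡1)

  no-ones : defect < 3 → ∀ i → c i ≢ 1
  no-ones defect<3 i ci≡1 = <⇒≱ defect<3 (defect≥3 ci≡1)

  deficit-even : (∀ i → c i ≢ 1) → ∀ i → 2 ∣ deficit i
  deficit-even c≢1 i = ∣m+n∣m⇒∣n (subst (2 ∣_) (sym (m+[n∸m]≡n (window≤4 i))) 2∣4) 2∣window
    where
    2∣c : ∀ j → 2 ∣ c j
    2∣c j = ≤2∧≢1⇒2∣ (c≤2 j) (c≢1 j)
    2∣window = ∣m∣n⇒∣m+n (∣m∣n⇒∣m+n (2∣c i) (2∣c (suc i))) (2∣c (suc (suc i)))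
    2∣4 : 2 ∣ 4
    2∣4 = ∣m∣n⇒∣m+n ∣-refl ∣-refl

  defect≢1 : defect ≢ 1
  defect≢1 defect≡1 = contradiction (∣1⇒≡1 2∣1) λ ()
    where
    2∣1 : 2 ∣ 1
    2∣1 = subst (2 ∣_) defect≡1
            (∑-even n deficit (deficit-even (no-ones (subst (_< 3) (sym defect≡1) (s≤s (s≤s z≤n))))))

  -- All deficits are even, so a positive one is 2 and its two neighbours vanish.
  defect≡2⇒isolated : defect ≡ 2 → ∃[ a ] c a ≡ 0 × 0 < c (suc a) × c (suc (suc a)) ≡ 0
  defect≡2⇒isolated defect≡2 with ∑-positive n deficit (subst (0 <_) (sym defect≡2) (s≤s z≤n))
  ... | j , 0<deficit[j] = suc b ,
        isolated-middle (c≤2 b) (c≤2 (4 + b)) (c≢1 _) (c≢1 _) (c≢1 _)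
                        (window-full deficit[b]≡0) window[1+b]<4 (window-full deficit[2+b]≡0)
    where
    c≢1 = no-ones (subst (_< 3) (sym defect≡2) ≤-refl)
    b = (n ∸ 1) + j
    deficit[1+b]≡deficit[j] : deficit (suc b) ≡ deficit j
    deficit[1+b]≡deficit[j] = trans (cong (λ m → deficit (m + j)) (m+[n∸m]≡n (≤-trans (s≤s z≤n) 3≤n)))
                                    (trans (cong deficit (+-comm n j)) (deficit-periodic j))
    0<deficit[1+b] : 0 < deficit (suc b)
    0<deficit[1+b] = subst (0 <_) (sym deficit[1+b]≡deficit[j]) 0<deficit[j]
    2≤deficit[1+b] : 2 ≤ deficit (suc b)
    2≤deficit[1+b] = ∣⇒≤ {{>-nonZero 0<deficit[1+b]}} (deficit-even c≢1 (suc b))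
    outer = sides-vanish (≤-trans (consecutive-deficits≤defect b) (≤-reflexive defect≡2)) 2≤deficit[1+b]
    deficit[b]≡0 = proj₁ outer
    deficit[2+b]≡0 = proj₂ outer
    window-full : ∀ {i} → deficit i ≡ 0 → 4 ≤ window i
    window-full = m∸n≡0⇒m≤n
    window[1+b]<4 : window (suc b) < 4
    window[1+b]<4 = ∸-cancelʳ-< {4} {window (suc b)} {4} 0<deficit[1+b]

data RTerm (s t : ℕ) : ℕ → Set where
  r≡0 : (s ⊓ t) % 3 ≢ 2 → RTerm s t 0
  r≡1 : (s ⊓ t) % 3 ≡ 2 → s ≡ t → RTerm s t 1
  r≡2 : (s ⊓ t) % 3 ≡ 2 → s ≢ t → RTerm s t 2

r-term-view : ∀ s t → RTerm s t (r-term s t)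
r-term-view s t with (s ⊓ t) % 3 ≟ 2
... | no min≢2 = r≡0 min≢2
... | yes min≡2 with s ≟ t
...   | yes s≡t = r≡1 min≡2 s≡t
...   | no s≢t  = r≡2 min≡2 s≢t

r-term-comm : ∀ s t → r-term s t ≡ r-term t s
r-term-comm s t with r-term s t | r-term-view s t | r-term t s | r-term-view t s
... | _ | r≡0 _        | _ | r≡0 _       = refl
... | _ | r≡1 _ _      | _ | r≡1 _ _     = refl
... | _ | r≡2 _ _      | _ | r≡2 _ _     = refl
... | _ | r≡0 min≢2    | _ | r≡1 min≡2 _ = contradiction (trans (cong (_% 3) (⊓-comm s t)) min≡2) min≢2
... | _ | r≡0 min≢2    | _ | r≡2 min≡2 _ = contradiction (trans (cong (_% 3) (⊓-comm s t)) min≡2) min≢2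
... | _ | r≡1 min≡2 _  | _ | r≡0 min≢2   = contradiction (trans (cong (_% 3) (⊓-comm t s)) min≡2) min≢2
... | _ | r≡2 min≡2 _  | _ | r≡0 min≢2   = contradiction (trans (cong (_% 3) (⊓-comm t s)) min≡2) min≢2
... | _ | r≡1 _ s≡t    | _ | r≡2 _ t≢s   = contradiction (sym s≡t) t≢s
... | _ | r≡2 _ s≢t    | _ | r≡1 _ t≡s   = contradiction (sym t≡s) s≢t

pred-bound : ∀ {n m k} → suc n ≤ m + suc k → n ≤ m + k
pred-bound {n} {m} {k} h = ≤-pred (subst (suc n ≤_) (+-suc m k) h)

remaining-residue : ∀ {ρ} → ρ < 3 → ρ ≢ 0 → ρ ≢ 2 → ρ ≡ 1
remaining-residue {0}                 _                        ρ≢0 _   = contradiction refl ρ≢0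
remaining-residue {1}                 _                        _   _   = refl
remaining-residue {2}                 _                        _   ρ≢2 = contradiction refl ρ≢2
remaining-residue {suc (suc (suc _))} (s≤s (s≤s (s≤s ()))) _   _

module _ {n D : ℕ} (s : ℕ) (3n+D≡4s : 3 * n + D ≡ 4 * s) where

  private
    q = s / 3
    ρ = s % 3
    4s≡3[4q+ρ]+ρ : 4 * s ≡ 3 * (4 * q + ρ) + ρ
    4s≡3[4q+ρ]+ρ = trans (cong (4 *_) (m≡m%n+[m/n]*n s 3)) (identity ρ q)
      where
      identity : ∀ ρ q → 4 * (ρ + q * 3) ≡ 3 * (4 * q + ρ) + ρ
      identity = solve-∀

  defect-bound : n ≤ 4 * (s / 3) + s % 3
  defect-bound = ≤-pred (*-cancelˡ-< 3 n (suc (4 * q + ρ)) (begin-strict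
    3 * n                      ≤⟨ m≤m+n (3 * n) D ⟩
    3 * n + D                  ≡⟨ trans 3n+D≡4s 4s≡3[4q+ρ]+ρ ⟩
    3 * (4 * q + ρ) + ρ        <⟨ +-monoʳ-< (3 * (4 * q + ρ)) (m%n<n s 3) ⟩
    3 * (4 * q + ρ) + 3        ≡⟨ trans (*-suc 3 (4 * q + ρ)) (+-comm 3 _) ⟨
    3 * suc (4 * q + ρ)        ∎))
    where open ≤-Reasoning

  D%3≡s%3 : D % 3 ≡ s % 3
  D%3≡s%3 = begin
    D % 3                         ≡⟨ [m+kn]%n≡m%n D n 3 ⟨
    (D + n * 3) % 3               ≡⟨ cong (_% 3) (trans (+-comm D (n * 3)) (cong (_+ D) (*-comm n 3))) ⟩
    (3 * n + D) % 3               ≡⟨ cong (_% 3) (trans 3n+D≡4s 4s≡3[4q+ρ]+ρ) ⟩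
    (3 * (4 * q + ρ) + ρ) % 3     ≡⟨ cong (_% 3) (trans (+-comm _ ρ) (cong (ρ +_) (*-comm 3 (4 * q + ρ)))) ⟩
    (ρ + (4 * q + ρ) * 3) % 3     ≡⟨ [m+kn]%n≡m%n ρ (4 * q + ρ) 3 ⟩
    ρ % 3                         ≡⟨ m%n%n≡m%n s 3 ⟩
    ρ                             ∎
    where open ≡-Reasoning

  defect-bound-strict : D ≢ s % 3 → suc n ≤ 4 * (s / 3) + s % 3
  defect-bound-strict D≢ρ = *-cancelˡ-≤ 3 (+-cancelʳ-≤ ρ _ _ (begin
    3 * suc n + ρ             ≡⟨ rearrange n ρ ⟩
    3 * n + (ρ + 3)           ≤⟨ +-monoʳ-≤ (3 * n) ρ+3≤D ⟩
    3 * n + D                 ≡⟨ trans 3n+D≡4s 4s≡3[4q+ρ]+ρ ⟩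
    3 * (4 * q + ρ) + ρ       ∎))
    where
    open ≤-Reasoning
    rearrange : ∀ n ρ → 3 * suc n + ρ ≡ 3 * n + (ρ + 3)
    rearrange = solve-∀
    D/3≢0 : D / 3 ≢ 0
    D/3≢0 D/3≡0 = D≢ρ (begin-equality
      D                  ≡⟨ m≡m%n+[m/n]*n D 3 ⟩
      D % 3 + D / 3 * 3  ≡⟨ cong₂ (λ x y → x + y * 3) D%3≡s%3 D/3≡0 ⟩
      ρ + 0              ≡⟨ +-identityʳ ρ ⟩
      ρ                  ∎)
    ρ+3≤D : ρ + 3 ≤ D
    ρ+3≤D = begin
      ρ + 3                  ≤⟨ +-monoʳ-≤ ρ (*-monoʳ-≤ 3 (n≢0⇒n>0 D/3≢0)) ⟩
      ρ + 3 * (D / 3)        ≡⟨ cong₂ _+_ (sym D%3≡s%3) (*-comm 3 (D / 3)) ⟩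
      D % 3 + D / 3 * 3      ≡⟨ m≡m%n+[m/n]*n D 3 ⟨
      D                      ∎

-- Cliques of C_s ◇ C_t

module CliqueColumns
  (s t : ℕ) .{{_ : NonZero s}} .{{_ : NonZero t}} (4≤s : 4 ≤ s) (4≤t : 4 ≤ t)
  (W : List (Fin s × Fin t)) (W-unique : Unique W) (W-clique : IsClique (Cycle s ◇ Cycle t) W)
  where

  private
    module S = CycleGeometry s
    module T = CycleGeometry t
    open ModularProduct (Cycle s) (Cycle t)
    _~ˢ_ = CycleAdj s
    _~ᵗ_ = CycleAdj t
    S-irrefl : ∀ {g} → ¬ g ~ˢ g
    S-irrefl = S.adjacent-irrefl (≤-trans (m≤m+n 2 2) 4≤s)

  open S using (⟦_⟧)

  column : ℕ → List (Fin s × Fin t)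
  column i = filter (λ x → proj₁ x ≟ᶠ ⟦ i ⟧) W

  count : ℕ → ℕ
  count i = length (column i)

  column-unique : ∀ i → Unique (column i)
  column-unique i = Unique.filter⁺ (λ x → proj₁ x ≟ᶠ ⟦ i ⟧) W-unique

  ∈-column⁻ : ∀ {i x} → x ∈ column i → x ∈ W × proj₁ x ≡ ⟦ i ⟧
  ∈-column⁻ {i} = ∈-filter⁻ (λ x → proj₁ x ≟ᶠ ⟦ i ⟧) {xs = W}

  ∈-column⁺ : ∀ {i x} → x ∈ W → proj₁ x ≡ ⟦ i ⟧ → x ∈ column i
  ∈-column⁺ {i} = ∈-filter⁺ (λ x → proj₁ x ≟ᶠ ⟦ i ⟧)

  count-periodic : ∀ i → count (i + s) ≡ count i
  count-periodic i = cong (λ g → length (filter (λ x → proj₁ x ≟ᶠ g) W)) (S.⟦⟧-periodic i)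

  ∑-count : ∑< s count ≡ length W
  ∑-count = trans (∑-cong s (λ i i<s → cong length (filter-≐ _ (λ x → toℕ (proj₁ x) ≟ i) (in-column⇔ i<s) W)))
                  (∑-length-filter-≟ s (toℕ ∘ proj₁) W (λ {x} _ → toℕ<n (proj₁ x)))
    where
    in-column⇔ : ∀ {i} → i < s → (λ (x : Fin s × Fin t) → proj₁ x ≡ ⟦ i ⟧) ≐ (λ x → toℕ (proj₁ x) ≡ i)
    in-column⇔ {i} i<s = (λ x≡i → trans (cong toℕ x≡i) (trans (S.toℕ-⟦⟧ i) (m<n⇒m%n≡m i<s))) ,
                         (λ x≡i → trans (sym (S.⟦toℕ⟧ _)) (cong ⟦_⟧ x≡i))

  rows-of-same-column : ∀ {x y} → x ∈ W → y ∈ W → x ≢ y → proj₁ x ≡ proj₁ y → proj₂ x ~ᵗ proj₂ y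
  rows-of-same-column {g , _} {.g , _} x∈W y∈W x≢y refl = ◇-same-first S-irrefl (W-clique x∈W y∈W x≢y)

  rows-of-adjacent-columns : ∀ {x y} → x ∈ W → y ∈ W → proj₁ x ~ˢ proj₁ y → Close (Cycle t) (proj₂ x) (proj₂ y)
  rows-of-adjacent-columns x∈W y∈W x~y = ◇-adjacent-first S-irrefl x~y (W-clique x∈W y∈W λ { refl → S-irrefl x~y })

  rows-of-far-columns : ∀ {x y} → x ∈ W → y ∈ W → Far (Cycle s) (proj₁ x) (proj₁ y) →
                        Far (Cycle t) (proj₂ x) (proj₂ y)
  rows-of-far-columns x∈W y∈W x⋯y = ◇-far-first x⋯y (W-clique x∈W y∈W (proj₁ x⋯y ∘ cong proj₁))

  pair-in-end-column⇒⊥ : ∀ {p q a b} → p ∈ W → q ∈ W → a ∈ W → b ∈ W → p ≢ q → proj₁ p ≡ proj₁ q →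
                         proj₁ p ~ˢ proj₁ a → proj₁ a ~ˢ proj₁ b → Far (Cycle s) (proj₁ p) (proj₁ b) → ⊥
  pair-in-end-column⇒⊥ {p} {q} {a} {b} p∈W q∈W a∈W b∈W p≢q p≡q p~a a~b p⋯b
    with T.close-to-adjacent-pair 4≤t (rows-of-same-column p∈W q∈W p≢q p≡q)
           (rows-of-adjacent-columns a∈W p∈W (S.adjacent-sym p~a))
           (rows-of-adjacent-columns a∈W q∈W (S.adjacent-sym (subst (_~ˢ proj₁ a) p≡q p~a)))
  ... | inj₁ ha≡hp = close⇒¬far (Cycle t) (subst (λ h → Close (Cycle t) h (proj₂ b)) ha≡hp a≈b)
                                (rows-of-far-columns p∈W b∈W p⋯b)
    where a≈b = rows-of-adjacent-columns a∈W b∈W a~b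
  ... | inj₂ ha≡hq = close⇒¬far (Cycle t) (subst (λ h → Close (Cycle t) h (proj₂ b)) ha≡hq a≈b)
                                (rows-of-far-columns q∈W b∈W (subst (λ g → Far (Cycle s) g (proj₁ b)) p≡q p⋯b))
    where a≈b = rows-of-adjacent-columns a∈W b∈W a~b

  pair-in-middle-column⇒⊥ : ∀ {p q a b} → p ∈ W → q ∈ W → a ∈ W → b ∈ W → p ≢ q → proj₁ p ≡ proj₁ q →
                            proj₁ a ~ˢ proj₁ p → proj₁ p ~ˢ proj₁ b → Far (Cycle s) (proj₁ a) (proj₁ b) → ⊥
  pair-in-middle-column⇒⊥ {p} {q} p∈W q∈W a∈W b∈W p≢q p≡q a~p p~b a⋯b =
    close⇒¬far (Cycle t) (both-close (near b∈W (S.adjacent-sym p~b)) (near a∈W a~p)) (rows-of-far-columns a∈W b∈W a⋯b)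
    where
    hp~hq = rows-of-same-column p∈W q∈W p≢q p≡q
    near : ∀ {x} → x ∈ W → proj₁ x ~ˢ proj₁ p → proj₂ x ≡ proj₂ p ⊎ proj₂ x ≡ proj₂ q
    near x∈W x~p = T.close-to-adjacent-pair 4≤t hp~hq (rows-of-adjacent-columns x∈W p∈W x~p)
                     (rows-of-adjacent-columns x∈W q∈W (subst (_ ~ˢ_) p≡q x~p))
    both-close : ∀ {hb ha} → hb ≡ proj₂ p ⊎ hb ≡ proj₂ q → ha ≡ proj₂ p ⊎ ha ≡ proj₂ q →
                 Close (Cycle t) ha hb
    both-close (inj₁ refl) (inj₁ refl) = inj₁ refl
    both-close (inj₂ refl) (inj₂ refl) = inj₁ refl
    both-close (inj₂ refl) (inj₁ refl) = inj₂ hp~hq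
    both-close (inj₁ refl) (inj₂ refl) = inj₂ (T.adjacent-sym hp~hq)

  private
    in-W : ∀ {i x} → x ∈ column i → x ∈ W
    in-W = proj₁ ∘ ∈-column⁻
    at : ∀ {i x} → x ∈ column i → proj₁ x ≡ ⟦ i ⟧
    at = proj₂ ∘ ∈-column⁻
    same : ∀ {i x y} → x ∈ column i → y ∈ column i → proj₁ x ≡ proj₁ y
    same x∈ y∈ = trans (at x∈) (sym (at y∈))
    adjacent : ∀ {i x y} → x ∈ column i → y ∈ column (suc i) → proj₁ x ~ˢ proj₁ y
    adjacent {i} x∈ y∈ = subst₂ _~ˢ_ (sym (at x∈)) (sym (at y∈)) (S.⟦⟧-adjacent i)
    far : ∀ {i x y} → x ∈ column i → y ∈ column (suc (suc i)) → Far (Cycle s) (proj₁ x) (proj₁ y)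
    far {i} x∈ y∈ = subst₂ (Far (Cycle s)) (sym (at x∈)) (sym (at y∈))
                      (S.⟦⟧-far (≤-reflexive (+-comm i 2)) (≤-trans (≤-reflexive (2+i+2≡i+4 i)) (+-monoʳ-≤ i 4≤s)))
      where
      2+i+2≡i+4 : ∀ i → 2 + i + 2 ≡ i + 4
      2+i+2≡i+4 = solve-∀

  count≤2 : ∀ i → count i ≤ 2
  count≤2 i with count i ≤? 2
  ... | yes ≤2 = ≤2
  ... | no ≰2 with three-distinct (column-unique i) (≰⇒> ≰2)
  ...   | x , y , z , x∈ , y∈ , z∈ , x≢y , x≢z , y≢z =
    ⊥-elim (T.triangle-free 4≤t (rows x∈ y∈ x≢y) (rows x∈ z∈ x≢z) (rows y∈ z∈ y≢z))
    where
    rows : ∀ {u v} → u ∈ column i → v ∈ column i → u ≢ v → proj₂ u ~ᵗ proj₂ v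
    rows u∈ v∈ u≢v = rows-of-same-column (in-W u∈) (in-W v∈) u≢v (same u∈ v∈)

  private
    no-pair⇒count≤1 : ∀ i → (∀ {p q} → p ∈ column i → q ∈ column i → p ≢ q → ⊥) → count i ≤ 1
    no-pair⇒count≤1 i no-pair with count i ≤? 1
    ... | yes ≤1 = ≤1
    ... | no ≰1 with two-distinct (column-unique i) (≰⇒> ≰1)
    ...   | p , q , p∈ , q∈ , p≢q = ⊥-elim (no-pair p∈ q∈ p≢q)

  counts-in-run : ∀ i → 0 < count i → 0 < count (suc i) → 0 < count (suc (suc i)) →
                  count i ≤ 1 × count (suc i) ≤ 1 × count (suc (suc i)) ≤ 1
  counts-in-run i 0<c₀ 0<c₁ 0<c₂ with 0<length⇒∈ 0<c₀ | 0<length⇒∈ 0<c₁ | 0<length⇒∈ 0<c₂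
  ... | a₀ , a₀∈ | a₁ , a₁∈ | a₂ , a₂∈ =
    no-pair⇒count≤1 i (λ p∈ q∈ p≢q →
      pair-in-end-column⇒⊥ (in-W p∈) (in-W q∈) (in-W a₁∈) (in-W a₂∈) p≢q (same p∈ q∈)
                           (adjacent p∈ a₁∈) (adjacent a₁∈ a₂∈) (far p∈ a₂∈)) ,
    no-pair⇒count≤1 (suc i) (λ p∈ q∈ p≢q →
      pair-in-middle-column⇒⊥ (in-W p∈) (in-W q∈) (in-W a₀∈) (in-W a₂∈) p≢q (same p∈ q∈)
                              (adjacent a₀∈ p∈) (adjacent p∈ a₂∈) (far a₀∈ a₂∈)) ,
    no-pair⇒count≤1 (suc (suc i)) (λ p∈ q∈ p≢q →
      pair-in-end-column⇒⊥ (in-W p∈) (in-W q∈) (in-W a₁∈) (in-W a₀∈) p≢q (same p∈ q∈)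
                           (S.adjacent-sym (adjacent a₁∈ p∈)) (S.adjacent-sym (adjacent a₀∈ a₁∈))
                           (far-sym (Cycle s) S.adjacent-sym (far a₀∈ p∈)))

  isolated-column⇒lonely-row : ∀ q → count q ≡ 0 → 0 < count (suc q) → count (suc (suc q)) ≡ 0 →
                               ∃[ x ] x ∈ W × (∀ {y} → y ∈ W → proj₂ y ≡ proj₂ x → y ≡ x)
  isolated-column⇒lonely-row q c₀≡0 0<c₁ c₂≡0 with 0<length⇒∈ 0<c₁
  ... | x , x∈ = x , in-W x∈ , lonely
    where
    empty : ∀ {i y} → count i ≡ 0 → y ∈ W → proj₁ y ≢ ⟦ i ⟧
    empty c≡0 y∈W y∈i = <⇒≢ (∈⇒0<length (∈-column⁺ y∈W y∈i)) (sym c≡0)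
    lonely : ∀ {y} → y ∈ W → proj₂ y ≡ proj₂ x → y ≡ x
    lonely {y} y∈W same-row with proj₁ y ≟ᶠ proj₁ x | S.adjacent? (proj₁ y) (proj₁ x)
    ... | yes same-column | _ = ×-≡,≡→≡ (same-column , same-row)
    ... | no _ | yes y~x with S.adjacent-⟦suc⟧ q (subst (proj₁ y ~ˢ_) (at x∈) y~x)
    ...   | inj₁ y∈q   = ⊥-elim (empty c₀≡0 y∈W y∈q)
    ...   | inj₂ y∈q+2 = ⊥-elim (empty c₂≡0 y∈W y∈q+2)
    lonely {y} y∈W same-row | no y≢x | no y≁x =
      ⊥-elim (proj₁ (rows-of-far-columns y∈W (in-W x∈) (y≢x , y≁x)) same-row)

module CliqueBound
  (s t : ℕ) .{{_ : NonZero s}} .{{_ : NonZero t}} (4≤s : 4 ≤ s) (s≤t : s ≤ t)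
  (W : List (Fin s × Fin t)) (W-unique : Unique W) (W-clique : IsClique (Cycle s ◇ Cycle t) W)
  where

  private
    4≤t = ≤-trans 4≤s s≤t
    module Cols = CliqueColumns s t 4≤s 4≤t W W-unique W-clique
    module Rows = CliqueColumns t s 4≤t 4≤s (map swap W) (transpose-unique W-unique)
                                (transpose-clique (Cycle s) (Cycle t) W-clique)
    module ColWin = CyclicWindows s (≤-trans (n≤1+n 3) 4≤s) Cols.count Cols.count-periodic Cols.count≤2 Cols.counts-in-run
    module RowWin = CyclicWindows t (≤-trans (n≤1+n 3) 4≤t) Rows.count Rows.count-periodic Rows.count≤2 Rows.counts-in-run

    column-equation : 3 * length W + ColWin.defect ≡ 4 * s
    column-equation = trans (cong (λ n → 3 * n + ColWin.defect) (sym Cols.∑-count)) ColWin.defect-equation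

    row-equation : 3 * length W + RowWin.defect ≡ 4 * t
    row-equation = trans (cong (λ n → 3 * n + RowWin.defect) (sym (trans Rows.∑-count (length-map swap W))))
                         RowWin.defect-equation

    lonely-row⇒row-count≡1 : ∀ {x} → x ∈ W → (∀ {y} → y ∈ W → proj₂ y ≡ proj₂ x → y ≡ x) →
                             Rows.count (toℕ (proj₂ x)) ≡ 1
    lonely-row⇒row-count≡1 {x} x∈W lonely =
      length≡1 (Rows.column-unique _) (Rows.∈-column⁺ (∈-map⁺ swap x∈W) (sym (⟦toℕ⟧ (proj₂ x)))) only-x
      where
      open CycleGeometry t using (⟦toℕ⟧)
      only-x : ∀ {y} → y ∈ Rows.column (toℕ (proj₂ x)) → y ≡ swap x
      only-x y∈ with Rows.∈-column⁻ y∈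
      ... | y∈swapW , y-row with ∈-map⁻ swap y∈swapW
      ...   | y′ , y′∈W , refl = cong swap (lonely y′∈W (trans y-row (⟦toℕ⟧ (proj₂ x))))

    square⇒defect≢2 : s ≡ t → ColWin.defect ≢ 2
    square⇒defect≢2 s≡t defect≡2 =
      let q , c₀≡0 , 0<c₁ , c₂≡0 = ColWin.defect≡2⇒isolated defect≡2
          x , x∈W , lonely        = Cols.isolated-column⇒lonely-row q c₀≡0 0<c₁ c₂≡0
      in <⇒≱ ≤-refl (subst (3 ≤_) row-defect≡2
                       (RowWin.defect≥3 {toℕ (proj₂ x)} (lonely-row⇒row-count≡1 x∈W lonely)))
      where
      row-defect≡2 : RowWin.defect ≡ 2
      row-defect≡2 = trans (+-cancelˡ-≡ (3 * length W) _ _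
                             (trans row-equation (trans (cong (4 *_) (sym s≡t)) (sym column-equation))))
                           defect≡2

    s%3≡min%3 : s % 3 ≡ (s ⊓ t) % 3
    s%3≡min%3 = cong (_% 3) (sym (m≤n⇒m⊓n≡m s≤t))

  clique-bound : length W ≤ 4 * (s / 3) + r-term s t
  clique-bound = bound (r-term-view s t)
    where
    bound : ∀ {r} → RTerm s t r → length W ≤ 4 * (s / 3) + r
    bound (r≡0 min≢2) with s % 3 ≟ 0
    ... | yes ρ≡0 = subst (λ ρ → length W ≤ 4 * (s / 3) + ρ) ρ≡0 (defect-bound s column-equation)
    ... | no ρ≢0  = pred-bound (subst (λ ρ → suc (length W) ≤ 4 * (s / 3) + ρ) ρ≡1
                      (defect-bound-strict s column-equation (λ D≡ρ → ColWin.defect≢1 (trans D≡ρ ρ≡1))))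
      where
      ρ≡1 : s % 3 ≡ 1
      ρ≡1 = remaining-residue (m%n<n s 3) ρ≢0 (min≢2 ∘ trans (sym s%3≡min%3))
    bound (r≡1 min≡2 s≡t) = pred-bound (subst (λ ρ → suc (length W) ≤ 4 * (s / 3) + ρ) ρ≡2
                              (defect-bound-strict s column-equation (λ D≡ρ → square⇒defect≢2 s≡t (trans D≡ρ ρ≡2))))
      where
      ρ≡2 : s % 3 ≡ 2
      ρ≡2 = trans s%3≡min%3 min≡2
    bound (r≡2 min≡2 _) = subst (λ ρ → length W ≤ 4 * (s / 3) + ρ) (trans s%3≡min%3 min≡2)
                                (defect-bound s column-equation)

module MaximumClique (s t : ℕ) .{{_ : NonZero s}} .{{_ : NonZero t}} (2≤s : 2 ≤ s) (s≤t : s ≤ t) where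

  private
    module S = CycleGeometry s
    module T = CycleGeometry t
    open ModularProduct (Cycle s) (Cycle t)
    k = s / 3

  cell : ℕ × ℕ → Fin s × Fin t
  cell (a , b) = S.⟦ a ⟧ , T.⟦ b ⟧

  data Compatible : ℕ × ℕ → ℕ × ℕ → Set where
    vertical     : ∀ {a b} → Compatible (a , b) (a , suc b)
    horizontal   : ∀ {a b} → Compatible (a , b) (suc a , b)
    diagonal     : ∀ {a b} → Compatible (a , b) (suc a , suc b)
    antidiagonal : ∀ {a b} → Compatible (a , suc b) (suc a , b)
    separated    : ∀ {a b a′ b′} → a + 2 ≤ a′ → a′ + 2 ≤ a + s → b + 2 ≤ b′ → b′ + 2 ≤ b + t →
                   Compatible (a , b) (a′ , b′)

  compatible⇒adjacent : ∀ {c c′} → Compatible c c′ → ModAdj (Cycle s) (Cycle t) (cell c) (cell c′)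
  compatible⇒adjacent {a , b} vertical     = inj₁ (refl , T.⟦⟧-adjacent b)
  compatible⇒adjacent {a , b} horizontal   = inj₂ (inj₁ (S.⟦⟧-adjacent a , refl))
  compatible⇒adjacent {a , b} diagonal     = inj₂ (inj₂ (inj₁ (S.⟦⟧-adjacent a , T.⟦⟧-adjacent b)))
  compatible⇒adjacent {a , suc b} antidiagonal = inj₂ (inj₂ (inj₁ (S.⟦⟧-adjacent a , T.adjacent-sym (T.⟦⟧-adjacent b))))
  compatible⇒adjacent (separated a+2≤a′ a′+2≤a+s b+2≤b′ b′+2≤b+t) =
    far×far⇒◇ (S.⟦⟧-far a+2≤a′ a′+2≤a+s) (T.⟦⟧-far b+2≤b′ b′+2≤b+t)

  block : ℕ → List (ℕ × ℕ)
  block i = (3 * i , 3 * i) ∷ (3 * i , suc (3 * i)) ∷ (suc (3 * i) , 3 * i) ∷ (suc (3 * i) , suc (3 * i)) ∷ []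

  block-compatible : ∀ i → AllPairs Compatible (block i)
  block-compatible i =
    (vertical ∷ horizontal ∷ diagonal ∷ []) ∷ (antidiagonal ∷ horizontal ∷ []) ∷ (vertical ∷ []) ∷ [] ∷ []

  ∈-block : ∀ {i x} → x ∈ block i →
            3 * i ≤ proj₁ x × proj₁ x ≤ suc (3 * i) × 3 * i ≤ proj₂ x × proj₂ x ≤ suc (3 * i)
  ∈-block (here refl)                         = ≤-refl    , n≤1+n _ , ≤-refl    , n≤1+n _
  ∈-block (there (here refl))                 = ≤-refl    , n≤1+n _ , n≤1+n _   , ≤-refl
  ∈-block (there (there (here refl)))         = n≤1+n _   , ≤-refl  , ≤-refl    , n≤1+n _
  ∈-block (there (there (there (here refl)))) = n≤1+n _   , ≤-refl  , n≤1+n _   , ≤-refl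

  blocks : ℕ → List (ℕ × ℕ)
  blocks zero    = []
  blocks (suc i) = blocks i ++ block i

  length-blocks : ∀ i → length (blocks i) ≡ 4 * i
  length-blocks zero    = refl
  length-blocks (suc i) = begin
    length (blocks i ++ block i)   ≡⟨ length-++ (blocks i) ⟩
    length (blocks i) + 4          ≡⟨ cong (_+ 4) (length-blocks i) ⟩
    4 * i + 4                      ≡⟨ +-comm (4 * i) 4 ⟩
    4 + 4 * i                      ≡⟨ *-suc 4 i ⟨
    4 * suc i                      ∎
    where open ≡-Reasoning

  private
    ≤1+3i⇒+2≤3[1+i] : ∀ {a} i → a ≤ suc (3 * i) → a + 2 ≤ 3 * suc i
    ≤1+3i⇒+2≤3[1+i] {a} i a≤1+3i = ≤-trans (+-monoˡ-≤ 2 a≤1+3i) (≤-reflexive (identity i))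
      where
      identity : ∀ i → suc (3 * i) + 2 ≡ 3 * suc i
      identity = solve-∀

  ∈-blocks : ∀ {i x} → x ∈ blocks i → proj₁ x + 2 ≤ 3 * i × proj₂ x + 2 ≤ 3 * i
  ∈-blocks {suc i} x∈ with ∈-++⁻ (blocks i) x∈
  ... | inj₁ x∈blocks = let (x₁+2≤ , x₂+2≤) = ∈-blocks {i} x∈blocks
                        in ≤-trans x₁+2≤ 3i≤3[1+i] , ≤-trans x₂+2≤ 3i≤3[1+i]
    where 3i≤3[1+i] = *-monoʳ-≤ 3 (n≤1+n i)
  ... | inj₂ x∈block  = let (_ , x₁≤ , _ , x₂≤) = ∈-block {i} x∈block
                        in ≤1+3i⇒+2≤3[1+i] i x₁≤ , ≤1+3i⇒+2≤3[1+i] i x₂≤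

  beyond-blocks : ∀ {i x y} → x ∈ blocks i → 3 * i ≤ proj₁ y → 3 * i ≤ proj₂ y →
                  proj₁ y + 2 ≤ s → proj₂ y + 2 ≤ t → Compatible x y
  beyond-blocks {i} {x} x∈ 3i≤y₁ 3i≤y₂ y₁+2≤s y₂+2≤t with ∈-blocks {i} x∈
  ... | x₁+2≤3i , x₂+2≤3i = separated (≤-trans x₁+2≤3i 3i≤y₁) (≤-trans y₁+2≤s (m≤n+m s (proj₁ x)))
                                      (≤-trans x₂+2≤3i 3i≤y₂) (≤-trans y₂+2≤t (m≤n+m t (proj₂ x)))

  blocks-compatible : ∀ i → 3 * i ≤ s → AllPairs Compatible (blocks i)
  blocks-compatible zero    _       = []
  blocks-compatible (suc i) 3[1+i]≤s =
    AllPairs.++⁺ (blocks-compatible i (≤-trans (*-monoʳ-≤ 3 (n≤1+n i)) 3[1+i]≤s)) (block-compatible i)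
      (All.tabulate λ x∈ → All.tabulate λ y∈ →
        let (3i≤y₁ , y₁≤ , 3i≤y₂ , y₂≤) = ∈-block {i} y∈
        in beyond-blocks {i} x∈ 3i≤y₁ 3i≤y₂ (≤-trans (≤1+3i⇒+2≤3[1+i] i y₁≤) 3[1+i]≤s)
                                         (≤-trans (≤1+3i⇒+2≤3[1+i] i y₂≤) (≤-trans 3[1+i]≤s s≤t)))

  -- When min(s, t) = 3k + 2, part of a further block still fits.
  corner : List (ℕ × ℕ)
  corner = (3 * k , 3 * k) ∷ (3 * k , suc (3 * k)) ∷ []

  extra : List (ℕ × ℕ)
  extra = take (r-term s t) corner

  private
    s≡3k+2 : (s ⊓ t) % 3 ≡ 2 → s ≡ 3 * k + 2
    s≡3k+2 min≡2 = begin
      s                  ≡⟨ m≡m%n+[m/n]*n s 3 ⟩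
      s % 3 + k * 3      ≡⟨ cong (_+ k * 3) (trans (cong (_% 3) (sym (m≤n⇒m⊓n≡m s≤t))) min≡2) ⟩
      2 + k * 3          ≡⟨ trans (+-comm 2 _) (cong (_+ 2) (*-comm k 3)) ⟩
      3 * k + 2          ∎
      where open ≡-Reasoning

    3k+2≤s : (s ⊓ t) % 3 ≡ 2 → 3 * k + 2 ≤ s
    3k+2≤s = ≤-reflexive ∘ sym ∘ s≡3k+2

  ∈-extra : ∀ {x} → x ∈ extra → 3 * k ≤ proj₁ x × 3 * k ≤ proj₂ x × proj₁ x + 2 ≤ s × proj₂ x + 2 ≤ t
  ∈-extra x∈ with r-term s t | r-term-view s t | x∈
  ... | _ | r≡1 min≡2 _   | here refl         = ≤-refl , ≤-refl , 3k+2≤s min≡2 , ≤-trans (3k+2≤s min≡2) s≤t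
  ... | _ | r≡2 min≡2 _   | here refl         = ≤-refl , ≤-refl , 3k+2≤s min≡2 , ≤-trans (3k+2≤s min≡2) s≤t
  ... | _ | r≡2 min≡2 s≢t | there (here refl) =
    ≤-refl , n≤1+n _ , 3k+2≤s min≡2 , subst (_≤ t) (cong suc (s≡3k+2 min≡2)) (≤∧≢⇒< s≤t s≢t)

  cells : List (ℕ × ℕ)
  cells = blocks k ++ extra

  cells-compatible : AllPairs Compatible cells
  cells-compatible =
    AllPairs.++⁺ (blocks-compatible k 3k≤s) (AllPairs.take⁺ (r-term s t) ((vertical ∷ []) ∷ [] ∷ []))
      (All.tabulate λ x∈ → All.tabulate λ y∈ →
        let (3k≤y₁ , 3k≤y₂ , y₁+2≤s , y₂+2≤t) = ∈-extra y∈
        in beyond-blocks {k} x∈ 3k≤y₁ 3k≤y₂ y₁+2≤s y₂+2≤t)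
    where
    3k≤s : 3 * k ≤ s
    3k≤s = subst (_≤ s) (*-comm k 3) (m/n*n≤m s 3)

  clique : List (Fin s × Fin t)
  clique = map cell cells

  clique-length : length clique ≡ 4 * (s / 3) + r-term s t
  clique-length = begin
    length (map cell cells)                  ≡⟨ length-map cell cells ⟩
    length (blocks k ++ extra)               ≡⟨ length-++ (blocks k) ⟩
    length (blocks k) + length extra         ≡⟨ cong₂ _+_ (length-blocks k) (length-take (r-term s t) corner) ⟩
    4 * k + r-term s t ⊓ 2                   ≡⟨ cong (4 * k +_) (m≤n⇒m⊓n≡m (r-term≤2 (r-term-view s t))) ⟩
    4 * k + r-term s t                       ∎
    where
    open ≡-Reasoning
    r-term≤2 : ∀ {r} → RTerm s t r → r ≤ 2
    r-term≤2 (r≡0 _)   = z≤n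
    r-term≤2 (r≡1 _ _) = s≤s z≤n
    r-term≤2 (r≡2 _ _) = s≤s (s≤s z≤n)

  clique-adjacent : AllPairs (ModAdj (Cycle s) (Cycle t)) clique
  clique-adjacent = AllPairs.map⁺ (AllPairs.map compatible⇒adjacent cells-compatible)

  clique-unique : Unique clique
  clique-unique = AllPairs.map (λ { x~y refl → ◇-irrefl S-irrefl T-irrefl x~y }) clique-adjacent
    where
    S-irrefl = S.adjacent-irrefl 2≤s
    T-irrefl = T.adjacent-irrefl (≤-trans 2≤s s≤t)

  clique-is-clique : IsClique (Cycle s ◇ Cycle t) clique
  clique-is-clique = AllPairs⇒pairwise (◇-sym S.adjacent-sym T.adjacent-sym) clique-adjacent

module CycleProduct (s t : ℕ) .{{_ : NonZero s}} .{{_ : NonZero t}} (7≤s : 7 ≤ s) (7≤t : 7 ≤ t) where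

  private
    module S = CycleGeometry s
    module T = CycleGeometry t
    open ModularProduct (Cycle s) (Cycle t)
    X = Cycle s ◇ Cycle t
    4≤s = ≤-trans (m≤m+n 4 3) 7≤s
    4≤t = ≤-trans (m≤m+n 4 3) 7≤t
    S-irrefl = S.adjacent-irrefl (≤-trans (m≤m+n 2 2) 4≤s)
    T-irrefl = T.adjacent-irrefl (≤-trans (m≤m+n 2 2) 4≤t)

  cliqueNumber : ℕ
  cliqueNumber = 4 * ((s / 3) ⊓ (t / 3)) + r-term s t

  private
    cliqueNumber-≤ : s ≤ t → 4 * (s / 3) + r-term s t ≡ cliqueNumber
    cliqueNumber-≤ s≤t = cong (λ k → 4 * k + r-term s t) (sym (m≤n⇒m⊓n≡m (/-monoˡ-≤ 3 s≤t)))

    cliqueNumber-≥ : t ≤ s → 4 * (t / 3) + r-term t s ≡ cliqueNumber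
    cliqueNumber-≥ t≤s = cong₂ (λ k r → 4 * k + r) (sym (m≥n⇒m⊓n≡n (/-monoˡ-≤ 3 t≤s))) (r-term-comm t s)

  maximum-clique : ∃[ W ] Unique W × IsClique X W × length W ≡ cliqueNumber
  maximum-clique with ≤-total s t
  ... | inj₁ s≤t = clique , clique-unique , clique-is-clique , trans clique-length (cliqueNumber-≤ s≤t)
    where open MaximumClique s t (≤-trans (m≤m+n 2 2) 4≤s) s≤t
  ... | inj₂ t≤s = map swap clique , transpose-unique clique-unique , transpose-clique (Cycle t) (Cycle s) clique-is-clique ,
                   trans (length-map swap clique) (trans clique-length (cliqueNumber-≥ t≤s))
    where open MaximumClique t s (≤-trans (m≤m+n 2 2) 4≤t) t≤s

  clique-bound : ∀ W → Unique W → IsClique X W → length W ≤ cliqueNumber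
  clique-bound W W-unique W-clique with ≤-total s t
  ... | inj₁ s≤t = subst (length W ≤_) (cliqueNumber-≤ s≤t) (CliqueBound.clique-bound s t 4≤s s≤t W W-unique W-clique)
  ... | inj₂ t≤s = subst₂ _≤_ (length-map swap W) (cliqueNumber-≥ t≤s)
                          (CliqueBound.clique-bound t s 4≤t t≤s (map swap W) (transpose-unique W-unique)
                                                    (transpose-clique (Cycle s) (Cycle t) W-clique))

  vertices : List (Fin s × Fin t)
  vertices = cartesianProduct (allFin s) (allFin t)

  length-vertices : length vertices ≡ s * t
  length-vertices = trans (length-cartesianProduct (allFin s) (allFin t))
                          (cong₂ _*_ (length-tabulate {n = s} (λ i → i)) (length-tabulate {n = t} (λ i → i)))

  open DiameterTwo X (≡-dec _≟ᶠ_ _≟ᶠ_) (◇-adjacent? _≟ᶠ_ _≟ᶠ_ S.adjacent? T.adjacent?)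
                   (◇-sym S.adjacent-sym T.adjacent-sym) (◇-irrefl S-irrefl T-irrefl)
                   (◇-walk₂ (Cycle s) (Cycle t) S.adjacent-sym T.adjacent-sym (S.far-from-both 7≤s) (T.far-from-both 7≤t))

  strongMetricDim : StrongMetricDim X (dimFormula s t)
  strongMetricDim with maximum-clique
  ... | W₀ , W₀-unique , W₀-clique , length-W₀ = subst (StrongMetricDim X) dim≡formula
    (strongMetricDim-order∸cliqueNumber vertices
      (Unique.cartesianProduct⁺ (Unique.allFin⁺ s) (Unique.allFin⁺ t))
      (λ (g , h) → ∈-cartesianProduct⁺ (∈-allFin g) (∈-allFin h))
      W₀ W₀-unique W₀-clique
      (λ W W-unique W-clique → subst (length W ≤_) (sym length-W₀) (clique-bound W W-unique W-clique))
      (◇-private-neighbour (Cycle s) (Cycle t) S-irrefl (S.far-from-both 7≤s) (T.far-from-both 7≤t)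
                           (S.adjacent-far-extension 4≤s) (T.adjacent-far-extension 4≤t)))
    where
    dim≡formula : length vertices ∸ length W₀ ≡ dimFormula s t
    dim≡formula = trans (cong₂ _∸_ length-vertices length-W₀)
                        (sym (∸-+-assoc (s * t) (4 * ((s / 3) ⊓ (t / 3))) (r-term s t)))

proposition4p7 : (s t : ℕ) → 7 ≤ s → 7 ≤ t →
    StrongMetricDim (Cycle s ◇ Cycle t) (dimFormula s t)
proposition4p7 s@(suc _) t@(suc _) 7≤s 7≤t = CycleProduct.strongMetricDim s t 7≤s 7≤t
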